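{- Let $n = 2^k$ with $k \geq 1$, and let $\tilde{H}(n)$ be the graph defined below. Then $\tilde{H}(n)$ is $(n+1)$-regular of diameter two, and with $\Delta = \Delta(\tilde{H}(n)) = n+1$ we have $\lambda_{2,1}(\tilde{H}(n)) = \Delta^2 - \Delta + 1$.
   Context: Let $F$ be the finite field of order $n = 2^k$. The points of the projective plane $PG_2(n)$ are the equivalence classes of $F^3\setminus\{(0,0,0)\}$ under $(x_1,x_2,x_3) \equiv (cx_1,cx_2,cx_3)$ for $c \in F\setminus\{0\}$. The polarity graph $H$ has these $n^2+n+1$ points as vertices, two distinct points $(x_1,x_2,x_3)$ and $(y_1,y_2,y_3)$ being adjacent iff $x_1y_1 + x_2y_2 + x_3y_3 = 0$ (no loops). The vertices $(x,y,z)$ of $H$ with $x^2+y^2+z^2 = 0$ are exactly the vertices of degree $n$ in $H$ (there are $n+1$ of them); all other vertices have degree $n+1$. The graph $\tilde{H}(n)$ is obtained from $H$ by adding one new vertex adjacent to exactly the vertices of $H$ of degree $n$; it has $n^2+n+2$ vertices. An $L(2,1)$-labeling of a graph $G$ is a function $f: V(G)\to\mathbb{Z}$ such that $|f(x)-f(y)|\geq 2$ whenever $xy \in E(G)$ and $|f(x)-f(y)| \geq 1$ whenever the distance between $x$ and $y$ in $G$ is $2$; $\lambda_{2,1}(G)$ is the minimum, over all such labelings, of the difference between the largest and smallest label used. -}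

module Defs where

open import Data.Nat using (ℕ; suc; _^_) renaming (_≤_ to _≤ℕ_)
open import Data.Integer using (ℤ; ∣_∣; _-_; _≤_)
open import Data.Fin using (Fin)
open import Data.Fin.Properties renaming (_≟_ to _≟F_)
open import Data.List using (List; []; _∷_; map; length; filter; _++_; concatMap; allFin)
open import Data.Maybe using (Maybe; just; nothing)
open import Data.Product using (_×_; _,_; ∃; ∃₂)
open import Data.Sum using (_⊎_)
open import Data.Empty using (⊥)
open import Relation.Nullary using (¬_; Dec; yes; no)
open import Relation.Binary.PropositionalEquality using (_≡_; _≢_; refl; cong; cong₂)
open import Relation.Binary.Definitions using (DecidableEquality)
open import Function.Bundles using (_↔_; Inverse)
open import Algebra.Structures using (IsCommutativeRing)

record Field : Set₁ where
  field
    Carrier : Set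
    _+_ _*_ : Carrier → Carrier → Carrier
    -_      : Carrier → Carrier
    0# 1#   : Carrier
  infixl 6 _+_
  infixl 7 _*_
  field
    isCommutativeRing : IsCommutativeRing _≡_ _+_ _*_ -_ 0# 1#
    0≢1     : 0# ≢ 1#
    inverse : ∀ x → x ≢ 0# → ∃ λ y → x * y ≡ 1#

-- "F is a finite field of order q":  a field F together with a bijection
-- Fin q ↔ Carrier F.

-- Finite simple graphs, given by a vertex type, an explicit duplicate-free
-- list of all vertices, and a decidable adjacency relation.

record FinGraph : Set₁ where
  field
    V     : Set
    verts : List V
    _~_   : V → V → Set
    _~?_  : ∀ u v → Dec (u ~ v)

module _ (G : FinGraph) where
  open FinGraph G

  degree : V → ℕ
  degree u = length (filter (u ~?_) verts)

  Regular : ℕ → Set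
  Regular d = ∀ v → degree v ≡ d

  Dist2 : V → V → Set
  Dist2 u v = u ≢ v × ¬ (u ~ v) × ∃ λ w → u ~ w × w ~ v

  Diameter2 : Set
  Diameter2 = (∀ u v → u ≢ v → (u ~ v) ⊎ (∃ λ w → u ~ w × w ~ v))
            × (∃₂ λ u v → Dist2 u v)

  IsL21 : (V → ℤ) → Set
  IsL21 f = (∀ u v → u ~ v → 2 ≤ℕ ∣ f u - f v ∣)
          × (∀ u v → Dist2 u v → f u ≢ f v)

  HasSpan : (V → ℤ) → ℤ → Set
  HasSpan f s = (∀ u v → f u - f v ≤ s) × (∃₂ λ u v → f u - f v ≡ s)

  Lambda21≡ : ℤ → Set
  Lambda21≡ m = (∃ λ f → IsL21 f × HasSpan f m)
              × (∀ f s → IsL21 f → HasSpan f s → m ≤ s)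

module Polarity (F : Field) (q : ℕ) (e : Fin q ↔ Field.Carrier F) where
  open Field F
  open Inverse e

  C = Carrier

  _≟_ : DecidableEquality C
  x ≟ y with from x ≟F from y
  ... | yes p = yes (begin-proof p)
    where
      begin-proof : from x ≡ from y → x ≡ y
      begin-proof p = Relation.Binary.PropositionalEquality.trans
        (Relation.Binary.PropositionalEquality.sym (strictlyInverseˡ x))
        (Relation.Binary.PropositionalEquality.trans (cong to p) (strictlyInverseˡ y))
  ... | no ¬p = no λ x≡y → ¬p (cong from x≡y)

  elems : List C
  elems = map to (allFin q)

  -- Points of PG_2(F), represented by their unique normalised representative
  -- (first non-zero coordinate equal to 1): (1,y,z), (0,1,z), (0,0,1).
  data Point : Set where
    p1 : C → C → Point
    p2 : C → Point
    p3 : Point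

  coords : Point → C × C × C
  coords (p1 y z) = 1# , y , z
  coords (p2 z)   = 0# , 1# , z
  coords p3       = 0# , 0# , 1#

  points : List Point
  points = concatMap (λ y → map (p1 y) elems) elems ++ map p2 elems ++ p3 ∷ []

  _≟P_ : DecidableEquality Point
  p1 a b ≟P p1 c d with a ≟ c | b ≟ d
  ... | yes refl | yes refl = yes refl
  ... | no ne | _ = no λ { refl → ne refl }
  ... | yes _ | no ne = no λ { refl → ne refl }
  p1 _ _ ≟P p2 _ = no λ ()
  p1 _ _ ≟P p3 = no λ ()
  p2 _ ≟P p1 _ _ = no λ ()
  p2 a ≟P p2 c with a ≟ c
  ... | yes refl = yes refl
  ... | no ne = no λ { refl → ne refl }
  p2 _ ≟P p3 = no λ ()
  p3 ≟P p1 _ _ = no λ ()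
  p3 ≟P p2 _ = no λ ()
  p3 ≟P p3 = yes refl

  dot : Point → Point → C
  dot p r with coords p | coords r
  ... | x₁ , x₂ , x₃ | y₁ , y₂ , y₃ = (x₁ * y₁ + x₂ * y₂) + x₃ * y₃

  HAdj : Point → Point → Set
  HAdj p r = p ≢ r × dot p r ≡ 0#

  HAdj? : ∀ p r → Dec (HAdj p r)
  HAdj? p r with p ≟P r | dot p r ≟ 0#
  ... | yes eq | _ = no λ h → Data.Product.proj₁ h eq
  ... | no ne | yes d = yes (ne , d)
  ... | no ne | no nd = no λ h → nd (Data.Product.proj₂ h)

  H : FinGraph
  H = record { V = Point ; verts = points ; _~_ = HAdj ; _~?_ = HAdj? }

  TAdj : Maybe Point → Maybe Point → Set
  TAdj (just p) (just r) = HAdj p r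
  TAdj (just p) nothing  = degree H p ≡ q
  TAdj nothing (just r)  = degree H r ≡ q
  TAdj nothing nothing   = ⊥

  TAdj? : ∀ u v → Dec (TAdj u v)
  TAdj? (just p) (just r) = HAdj? p r
  TAdj? (just p) nothing  = degree H p Data.Nat.≟ q
  TAdj? nothing (just r)  = degree H r Data.Nat.≟ q
  TAdj? nothing nothing   = no λ ()

  Htilde : FinGraph
  Htilde = record
    { V = Maybe Point
    ; verts = nothing ∷ map just points
    ; _~_ = TAdj
    ; _~?_ = TAdj?
    }

module Submission where

-- Translation x ↦ x + 1 permutes F, so q·1 = 0; as F has no zero divisors,
-- 1 + 1 = 0.  Every line of PG_2(F) has q + 1 points, hence a point of H has
-- degree q if it is absolute (lies on its own polar line) and q + 1
-- otherwise.  In characteristic 2 the coordinates u = x + z, v = y + z,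
-- s = x + y + z turn the form into s s' + (u v' + v u'), so the absolute
-- points are the q + 1 points of the line s = 0, the polar of the nucleus
-- N = (1,1,1).  This makes H̃ (q+1)-regular, and a cross product provides
-- common neighbours, giving diameter two.
--
-- The q² + q points other than N lie on the q + 1 lines through N (fixed by
-- the ratio u : v), each carrying exactly one absolute point.  The labelling
-- gives the new vertex 0, N the label 1, and lists the lines in blocks of q
-- consecutive labels, moving the absolute point of each line to the end of
-- the next block.  Vertices with consecutive labels are then never adjacent,
-- so this is an L(2,1)-labelling of span q² + q + 1.  Conversely, in a graph
-- of diameter two all labels are distinct, so the q² + q + 2 vertices force
-- span at least q² + q + 1 = Δ² - Δ + 1.

open import Defs
import Data.Nat as ℕ
open import Data.Nat using (ℕ; zero; suc; _^_; NonZero)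
open import Data.Fin using (Fin)
open import Function.Bundles using (_↔_)
open import Relation.Binary.Definitions using (DecidableEquality)
open import Relation.Binary.PropositionalEquality using (_≡_)

module Counting where
  open import Data.Nat using (_+_; _*_)
  open import Data.Nat.Properties using (+-suc; *-zeroʳ; *-suc)
  open import Data.Nat.ListAction using (sum)
  open import Data.List using (List; []; _∷_; _++_; map; length; filter; concatMap; tabulate)
  open import Data.List.Properties using (filter-++; length-++; filter-all; filter-none; filter-≐)
  open import Data.List.Relation.Unary.All using (universal)
  open import Data.List.Relation.Unary.All.Properties using (tabulate⁺)
  open import Data.Fin using (Fin; zero; suc)
  open import Data.Fin.Properties using (suc-injective; 0≢1+n)
  open import Data.Product using (_,_)
  open import Data.Empty using (⊥-elim)
  open import Function using (_∘_)
  open import Relation.Nullary using (¬_; Dec; yes; no)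
  open import Relation.Nullary.Decidable using (_×-dec_; ¬?)
  open import Relation.Binary.PropositionalEquality

  module _ {A : Set} {P : A → Set} (P? : ∀ x → Dec (P x)) where

    -- The degree of a vertex in Defs is literally such a count.
    count : List A → ℕ
    count xs = length (filter P? xs)

    count-++ : ∀ xs ys → count (xs ++ ys) ≡ count xs + count ys
    count-++ xs ys = trans (cong length (filter-++ P? xs ys)) (length-++ (filter P? xs))

    count-all : (∀ x → P x) → ∀ xs → count xs ≡ length xs
    count-all all xs = cong length (filter-all P? (universal all xs))

    count-none : (∀ x → ¬ P x) → ∀ xs → count xs ≡ 0
    count-none none xs = cong length (filter-none P? (universal none xs))

    count-singleton-yes : ∀ x → P x → count (x ∷ []) ≡ 1
    count-singleton-yes x px with P? x
    ... | yes _ = refl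
    ... | no ¬px = ⊥-elim (¬px px)

    count-singleton-no : ∀ x → ¬ P x → count (x ∷ []) ≡ 0
    count-singleton-no x ¬px with P? x
    ... | yes px = ⊥-elim (¬px px)
    ... | no _ = refl

    count-tabulate-unique : ∀ {n} (g : Fin n → A) (j : Fin n) →
      (∀ i → P (g i) → i ≡ j) → P (g j) → count (tabulate g) ≡ 1
    count-tabulate-unique g zero only pj with P? (g zero)
    ... | no ¬p = ⊥-elim (¬p pj)
    ... | yes _ = cong suc (cong length (filter-none P? (tabulate⁺ λ i p → 0≢1+n (sym (only (suc i) p)))))
    count-tabulate-unique g (suc j) only pj with P? (g zero)
    ... | yes p = ⊥-elim (0≢1+n (only zero p))
    ... | no _ = count-tabulate-unique (g ∘ suc) j (λ i p → suc-injective (only (suc i) p)) pj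

  module _ {A : Set} {P Q : A → Set} (P? : ∀ x → Dec (P x)) (Q? : ∀ x → Dec (Q x)) where

    count-≐ : (∀ x → P x → Q x) → (∀ x → Q x → P x) → ∀ xs → count P? xs ≡ count Q? xs
    count-≐ P⇒Q Q⇒P xs = cong length (filter-≐ P? Q? ((λ {x} → P⇒Q x) , (λ {x} → Q⇒P x)) xs)

    count-split : ∀ xs → count P? xs ≡ count (λ x → Q? x ×-dec P? x) xs + count (λ x → ¬? (Q? x) ×-dec P? x) xs
    count-split [] = refl
    count-split (x ∷ xs) with P? x | Q? x
    ... | yes _ | yes _ = cong suc (count-split xs)
    ... | yes _ | no _ = trans (cong suc (count-split xs)) (sym (+-suc _ _))
    ... | no _ | yes _ = count-split xs
    ... | no _ | no _ = count-split xs

  module _ {A B : Set} {P : B → Set} (P? : ∀ x → Dec (P x)) where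

    count-map : ∀ (f : A → B) xs → count P? (map f xs) ≡ count (P? ∘ f) xs
    count-map f [] = refl
    count-map f (x ∷ xs) with P? (f x)
    ... | yes _ = cong suc (count-map f xs)
    ... | no _ = count-map f xs

    count-concatMap : ∀ (f : A → List B) xs → count P? (concatMap f xs) ≡ sum (map (count P? ∘ f) xs)
    count-concatMap f [] = refl
    count-concatMap f (x ∷ xs) = trans (count-++ P? (f x) _) (cong (count P? (f x) +_) (count-concatMap f xs))

  sum-indicator : ∀ {A : Set} {R : A → Set} (R? : ∀ x → Dec (R x)) (g : A → ℕ) m →
    (∀ x → R x → g x ≡ m) → (∀ x → ¬ R x → g x ≡ 0) → ∀ xs → sum (map g xs) ≡ m * count R? xs
  sum-indicator R? g m on off [] = sym (*-zeroʳ m)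
  sum-indicator R? g m on off (x ∷ xs) with R? x
  ... | yes r = trans (cong₂ _+_ (on x r) (sum-indicator R? g m on off xs)) (sym (*-suc m _))
  ... | no ¬r = cong₂ _+_ (off x ¬r) (sum-indicator R? g m on off xs)

module FieldFacts (F : Field) (_≟_ : DecidableEquality (Field.Carrier F)) where
  open import Data.Product using (proj₁; proj₂)
  open import Data.Sum using (_⊎_; inj₁; inj₂; [_,_]′)
  open import Function using (id)
  open import Data.Empty using (⊥-elim)
  open import Relation.Nullary using (yes; no)
  open import Relation.Binary.PropositionalEquality
  open import Algebra.Bundles using (CommutativeRing)

  open Field F public
  open import Algebra.Structures {A = Carrier} _≡_ using (IsCommutativeRing)
  open IsCommutativeRing isCommutativeRing public
    using (+-assoc; +-comm; +-identityˡ; +-identityʳ; -‿inverseˡ; -‿inverseʳ;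
           *-assoc; *-comm; *-identityˡ; *-identityʳ; distribˡ; distribʳ; zeroˡ; zeroʳ)

  ring : CommutativeRing _ _
  ring = record { isCommutativeRing = isCommutativeRing }

  open import Algebra.Properties.Ring (CommutativeRing.ring ring) public
    using (+-identityʳ-unique; +-inverseʳ-unique)
  open import Algebra.Solver.Ring.NaturalCoefficients.Default (CommutativeRing.commutativeSemiring ring) public
    using (solve; _:=_; _:+_; _:*_)

  open ≡-Reasoning

  1≢0 : 1# ≢ 0#
  1≢0 eq = 0≢1 (sym eq)

  one-plus-zero : ∀ {a b} → a ≡ 1# → b ≡ 0# → a + b ≡ 1#
  one-plus-zero refl refl = +-identityʳ 1#

  zero-plus-one : ∀ {a b} → a ≡ 0# → b ≡ 1# → a + b ≡ 1#
  zero-plus-one refl refl = +-identityˡ 1#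

  -- A total inverse function, with inv 0 = 0.
  inv : Carrier → Carrier
  inv x with x ≟ 0#
  ... | yes _ = 0#
  ... | no x≢0 = proj₁ (inverse x x≢0)

  *-inverseʳ : ∀ x → x ≢ 0# → x * inv x ≡ 1#
  *-inverseʳ x x≢0 with x ≟ 0#
  ... | yes x≡0 = ⊥-elim (x≢0 x≡0)
  ... | no x≢0′ = proj₂ (inverse x x≢0′)

  *-inverseˡ : ∀ x → x ≢ 0# → inv x * x ≡ 1#
  *-inverseˡ x x≢0 = trans (*-comm (inv x) x) (*-inverseʳ x x≢0)

  *-cancelˡ-0 : ∀ {a b} → a ≢ 0# → a * b ≡ 0# → b ≡ 0#
  *-cancelˡ-0 {a} {b} a≢0 ab≡0 = begin
    b                 ≡⟨ sym (*-identityˡ b) ⟩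
    1# * b            ≡⟨ cong (_* b) (sym (*-inverseˡ a a≢0)) ⟩
    (inv a * a) * b   ≡⟨ *-assoc (inv a) a b ⟩
    inv a * (a * b)   ≡⟨ cong (inv a *_) ab≡0 ⟩
    inv a * 0#        ≡⟨ zeroʳ (inv a) ⟩
    0# ∎

  *-cancelʳ-0 : ∀ {a b} → b ≢ 0# → a * b ≡ 0# → a ≡ 0#
  *-cancelʳ-0 {a} {b} b≢0 ab≡0 = *-cancelˡ-0 b≢0 (trans (*-comm b a) ab≡0)

  no-zero-divisors : ∀ {a b} → a * b ≡ 0# → a ≡ 0# ⊎ b ≡ 0#
  no-zero-divisors {a} ab≡0 with a ≟ 0#
  ... | yes a≡0 = inj₁ a≡0
  ... | no a≢0 = inj₂ (*-cancelˡ-0 a≢0 ab≡0)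

  *-nonzero : ∀ {a b} → a ≢ 0# → b ≢ 0# → a * b ≢ 0#
  *-nonzero a≢0 b≢0 ab≡0 = [ a≢0 , b≢0 ]′ (no-zero-divisors ab≡0)

  square-zero : ∀ {a} → a * a ≡ 0# → a ≡ 0#
  square-zero aa≡0 = [ id , id ]′ (no-zero-divisors aa≡0)

  inv-nonzero : ∀ x → x ≢ 0# → inv x ≢ 0#
  inv-nonzero x x≢0 inv≡0 = 1≢0 (begin
    1#          ≡⟨ sym (*-inverseʳ x x≢0) ⟩
    x * inv x   ≡⟨ cong (x *_) inv≡0 ⟩
    x * 0#      ≡⟨ zeroʳ x ⟩
    0# ∎)

  *-inv-cancelʳ : ∀ {c} w → c ≢ 0# → w * inv c * c ≡ w
  *-inv-cancelʳ {c} w c≢0 = begin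
    w * inv c * c     ≡⟨ *-assoc w (inv c) c ⟩
    w * (inv c * c)   ≡⟨ cong (w *_) (*-inverseˡ c c≢0) ⟩
    w * 1#            ≡⟨ *-identityʳ w ⟩
    w ∎

  *-inv-cancelˡ : ∀ {c} w → c ≢ 0# → c * w * inv c ≡ w
  *-inv-cancelˡ {c} w c≢0 = trans (cong (_* inv c) (*-comm c w)) (begin
    w * c * inv c     ≡⟨ *-assoc w c (inv c) ⟩
    w * (c * inv c)   ≡⟨ cong (w *_) (*-inverseʳ c c≢0) ⟩
    w * 1#            ≡⟨ *-identityʳ w ⟩
    w ∎)

  solve-linear : ∀ {c z w} → c ≢ 0# → c * z ≡ w → z ≡ w * inv c
  solve-linear {c} {z} {w} c≢0 cz≡w = begin
    z                 ≡⟨ sym (*-inv-cancelˡ z c≢0) ⟩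
    c * z * inv c     ≡⟨ cong (_* inv c) cz≡w ⟩
    w * inv c ∎

  cross-div : ∀ {a b c d} → a ≢ 0# → c ≢ 0# → a * d ≡ b * c → b * inv a ≡ d * inv c
  cross-div {a} {b} {c} {d} a≢0 c≢0 ad≡bc = solve-linear c≢0 (begin
    c * (b * inv a)   ≡⟨ solve 3 (λ c b i → c :* (b :* i) := b :* c :* i) refl c b (inv a) ⟩
    b * c * inv a     ≡⟨ cong (_* inv a) (sym ad≡bc) ⟩
    a * d * inv a     ≡⟨ *-inv-cancelˡ d a≢0 ⟩
    d ∎)

  rescale : ∀ {X Y a b} → a ≢ 0# → X * inv a ≡ Y * inv b → X ≡ (a * inv b) * Y
  rescale {X} {Y} {a} {b} a≢0 quotients≡ = begin
    X                   ≡⟨ sym (*-inv-cancelʳ X a≢0) ⟩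
    X * inv a * a       ≡⟨ cong (_* a) quotients≡ ⟩
    Y * inv b * a       ≡⟨ solve 3 (λ y i a → y :* i :* a := (a :* i) :* y) refl Y (inv b) a ⟩
    (a * inv b) * Y ∎

-- Translation by 1 permutes
-- the field, so Σ x = Σ (x + 1) = Σ x + q·1 and q·1 = 0; as 2^k · 1 = (2·1)^k
-- and a field has no zero divisors, 2·1 = 0.
module CharacteristicTwo (F : Field) (k : ℕ) (e : Fin (2 ^ k) ↔ Field.Carrier F) where
  open import Data.Sum using (inj₁; inj₂)
  open import Data.Empty using (⊥-elim)
  open import Relation.Binary.PropositionalEquality
  open import Function.Bundles using (Inverse)
  open import Algebra.Bundles using (CommutativeRing)
  open import Data.Fin.Permutation using (Permutation; permutation)

  open Polarity F (2 ^ k) e using (_≟_)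
  open FieldFacts F _≟_
  open Inverse e using (to; from; strictlyInverseˡ; strictlyInverseʳ)
  open CommutativeRing ring using (+-commutativeMonoid; semiring)
  open import Algebra.Properties.CommutativeMonoid.Sum +-commutativeMonoid
    using (sum; sum-permute; sum-cong-≗; ∑-distrib-+; sum-replicate)
  open import Algebra.Properties.Semiring.Mult semiring using (×1-homo-*) renaming (_×_ to _⨯_)
  open ≡-Reasoning

  q : ℕ
  q = 2 ^ k

  translation : Permutation q q
  translation = permutation (λ i → from (to i + 1#)) (λ i → from (to i + - 1#)) back forth
    where
    shift-back : ∀ x → x + - 1# + 1# ≡ x
    shift-back x = trans (+-assoc x (- 1#) 1#) (trans (cong (x +_) (-‿inverseˡ 1#)) (+-identityʳ x))
    shift-forth : ∀ x → x + 1# + - 1# ≡ x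
    shift-forth x = trans (+-assoc x 1# (- 1#)) (trans (cong (x +_) (-‿inverseʳ 1#)) (+-identityʳ x))
    back : ∀ i → from (to (from (to i + - 1#)) + 1#) ≡ i
    back i = trans (cong (λ x → from (x + 1#)) (strictlyInverseˡ _))
                   (trans (cong from (shift-back (to i))) (strictlyInverseʳ i))
    forth : ∀ i → from (to (from (to i + 1#)) + - 1#) ≡ i
    forth i = trans (cong (λ x → from (x + - 1#)) (strictlyInverseˡ _))
                    (trans (cong from (shift-forth (to i))) (strictlyInverseʳ i))

  order-annihilates-one : q ⨯ 1# ≡ 0#
  order-annihilates-one = +-identityʳ-unique (sum to) (q ⨯ 1#) (sym (begin
    sum to                                 ≡⟨ sum-permute to translation ⟩
    sum (λ i → to (from (to i + 1#)))      ≡⟨ sum-cong-≗ (λ i → strictlyInverseˡ (to i + 1#)) ⟩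
    sum (λ i → to i + 1#)                  ≡⟨ ∑-distrib-+ to (λ _ → 1#) ⟩
    sum to + sum {q} (λ _ → 1#)            ≡⟨ cong (sum to +_) (sum-replicate q) ⟩
    sum to + q ⨯ 1# ∎))

  two-power-zero : ∀ j → (2 ^ j) ⨯ 1# ≡ 0# → 1# + 1# ≡ 0#
  two-power-zero zero h = ⊥-elim (1≢0 (trans (sym (+-identityʳ 1#)) h))
  two-power-zero (suc j) h with no-zero-divisors (trans (sym (×1-homo-* 2 (2 ^ j))) h)
  ... | inj₁ two≡0 = trans (cong (1# +_) (sym (+-identityʳ 1#))) two≡0
  ... | inj₂ rest≡0 = two-power-zero j rest≡0

  characteristic-two : 1# + 1# ≡ 0#
  characteristic-two = two-power-zero k order-annihilates-one

module Plane (F : Field) (q : ℕ) (e : Fin q ↔ Field.Carrier F) where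
  import Data.Nat as ℕ
  import Data.Nat.Properties as ℕ
  open import Data.Nat.ListAction using (sum)
  open import Data.List using ([]; _∷_; map; length; allFin; concatMap)
  open import Data.List.Properties using (length-map; length-tabulate; map-cong)
  open import Data.Product using (_×_; _,_; proj₁; proj₂)
  open import Data.Empty using (⊥-elim)
  open import Data.Unit using (tt)
  open import Relation.Nullary using (¬_; Dec; yes; no)
  open import Relation.Nullary.Decidable using (_×-dec_; ¬?)
  open import Relation.Binary.PropositionalEquality
  open import Function.Bundles using (Inverse; Injection)
  open import Function.Construct.Identity using (↔-id)
  open import Function.Construct.Composition using (_↔-∘_)
  open import Function.Properties.Inverse using (↔⇒↣)
  open import Data.Sum using (_⊎_; inj₁; inj₂)
  open import Data.Sum.Function.Propositional using (_⊎-↔_)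
  open import Data.Fin using (zero; suc)
  open import Data.Fin.Properties using (+↔⊎; *↔×)
  open import Data.Maybe using (Maybe; just; nothing)

  open Polarity F q e public
  open FieldFacts F _≟_ public
  open Counting
  open Inverse e using (to; from; strictlyInverseˡ; strictlyInverseʳ)
  open ≡-Reasoning

  Vec3 : Set
  Vec3 = Carrier × Carrier × Carrier

  -- The bilinear form defining the polarity; dot p r is definitionally coords p · coords r.
  infix 7 _·_
  _·_ : Vec3 → Vec3 → Carrier
  (x , y , z) · (x' , y' , z') = (x * x' + y * y') + z * z'

  Nonzero : Vec3 → Set
  Nonzero (x , y , z) = ¬ (x ≡ 0# × y ≡ 0# × z ≡ 0#)

  orthogonal? : ∀ X (r : Point) → Dec (X · coords r ≡ 0#)
  orthogonal? X r = (X · coords r) ≟ 0#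

  ·-comm : ∀ X Y → X · Y ≡ Y · X
  ·-comm (x , y , z) (x' , y' , z') = cong₂ _+_ (cong₂ _+_ (*-comm x x') (*-comm y y')) (*-comm z z')

  dot-comm : ∀ p r → dot p r ≡ dot r p
  dot-comm p r = ·-comm (coords p) (coords r)

  length-elems : length elems ≡ q
  length-elems = trans (length-map to (allFin q)) (length-tabulate (λ i → i))

  module _ {P : Carrier → Set} (P? : ∀ x → Dec (P x)) where

    count-elems-unique : ∀ c → (∀ x → P x → x ≡ c) → P c → count P? elems ≡ 1
    count-elems-unique c only pc = trans (count-map P? to (allFin q))
      (count-tabulate-unique (λ i → P? (to i)) (λ i → i) (from c)
        (λ i p → trans (sym (strictlyInverseʳ i)) (cong from (only (to i) p)))
        (subst P (sym (strictlyInverseˡ c)) pc))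

    count-elems-all : (∀ x → P x) → count P? elems ≡ q
    count-elems-all all = trans (count-all P? all elems) length-elems

  sum-elems-const : ∀ (g : Carrier → ℕ) m → (∀ y → g y ≡ m) → sum (map g elems) ≡ m ℕ.* q
  sum-elems-const g m const = trans
    (sum-indicator (λ _ → yes tt) g m (λ y _ → const y) (λ y ¬⊤ → ⊥-elim (¬⊤ tt)) elems)
    (cong (m ℕ.*_) (count-elems-all (λ _ → yes tt) (λ _ → tt)))

  affine-roots : ∀ (f : Carrier → Carrier) α c → (∀ z → f z ≡ α + c * z) → c ≢ 0# →
    count (λ z → f z ≟ 0#) elems ≡ 1
  affine-roots f α c affine c≢0 = count-elems-unique (λ z → f z ≟ 0#) (- α * inv c)
    (λ z fz≡0 → solve-linear c≢0 (+-inverseʳ-unique α (c * z) (trans (sym (affine z)) fz≡0)))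
    (begin
      f (- α * inv c)         ≡⟨ affine (- α * inv c) ⟩
      α + c * (- α * inv c)   ≡⟨ cong (α +_) (trans (sym (*-assoc c (- α) (inv c))) (*-inv-cancelˡ (- α) c≢0)) ⟩
      α + - α                 ≡⟨ -‿inverseʳ α ⟩
      0# ∎)

  constant-roots : ∀ α (f : Carrier → Carrier) → (∀ z → f z ≡ α + 0# * z) → α ≡ 0# →
    count (λ z → f z ≟ 0#) elems ≡ q
  constant-roots α f constant α≡0 = count-elems-all (λ z → f z ≟ 0#) λ z → begin
    f z          ≡⟨ constant z ⟩
    α + 0# * z   ≡⟨ cong (α +_) (zeroˡ z) ⟩
    α + 0#       ≡⟨ +-identityʳ α ⟩
    α            ≡⟨ α≡0 ⟩
    0# ∎

  no-roots : ∀ α (f : Carrier → Carrier) → (∀ z → f z ≡ α + 0# * z) → α ≢ 0# →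
    count (λ z → f z ≟ 0#) elems ≡ 0
  no-roots α f constant α≢0 = count-none (λ z → f z ≟ 0#)
    (λ z fz≡0 → α≢0 (trans (sym (trans (cong (α +_) (zeroˡ z)) (+-identityʳ α))) (trans (sym (constant z)) fz≡0)))
    elems

  count-points : ∀ {P : Point → Set} (P? : ∀ r → Dec (P r)) →
    count P? points ≡ sum (map (λ y → count (λ z → P? (p1 y z)) elems) elems)
                      ℕ.+ (count (λ z → P? (p2 z)) elems ℕ.+ count P? (p3 ∷ []))
  count-points P? = trans (count-++ P? (concatMap (λ y → map (p1 y) elems) elems) _)
    (cong₂ ℕ._+_
      (trans (count-concatMap P? (λ y → map (p1 y) elems) elems)
             (cong sum (map-cong (λ y → count-map P? (p1 y) elems) elems)))
      (trans (count-++ P? (map p2 elems) (p3 ∷ []))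
             (cong (ℕ._+ count P? (p3 ∷ [])) (count-map P? p2 elems))))

  at-p1 : ∀ a y → a * 1# + 0# * y ≡ a
  at-p1 a y = trans (cong₂ _+_ (*-identityʳ a) (zeroˡ y)) (+-identityʳ a)

  at-p2 : ∀ a b → a * 0# + b * 1# ≡ b
  at-p2 a b = trans (cong₂ _+_ (zeroʳ a) (*-identityʳ b)) (+-identityˡ b)

  at-p3 : ∀ a b c → (a * 0# + b * 0#) + c * 1# ≡ c
  at-p3 a b c = trans (cong₂ _+_ (trans (cong₂ _+_ (zeroʳ a) (zeroʳ b)) (+-identityʳ 0#)) (*-identityʳ c)) (+-identityˡ c)

  line-size : ∀ X → Nonzero X → count (orthogonal? X) points ≡ suc q
  line-size (a , b , c) nonzero with c ≟ 0# | b ≟ 0#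
  ... | no c≢0 | _ = begin
    count (orthogonal? (a , b , c)) points
      ≡⟨ count-points (orthogonal? (a , b , c)) ⟩
    _ ≡⟨ cong₂ ℕ._+_ (sum-elems-const _ 1 (λ y → affine-roots _ _ c (λ _ → refl) c≢0))
                     (cong₂ ℕ._+_ (affine-roots _ _ c (λ _ → refl) c≢0)
                                  (count-singleton-no (orthogonal? (a , b , c)) p3 (λ h → c≢0 (trans (sym (at-p3 a b c)) h)))) ⟩
    1 ℕ.* q ℕ.+ 1   ≡⟨ cong (ℕ._+ 1) (ℕ.*-identityˡ q) ⟩
    q ℕ.+ 1         ≡⟨ ℕ.+-comm q 1 ⟩
    suc q ∎
  ... | yes refl | no b≢0 = begin
    count (orthogonal? (a , b , 0#)) points
      ≡⟨ count-points (orthogonal? (a , b , 0#)) ⟩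
    _ ≡⟨ cong₂ ℕ._+_ (trans (sum-indicator (λ y → (a * 1# + b * y) ≟ 0#) _ q
                                (λ y h → constant-roots _ _ (λ _ → refl) h) (λ y h → no-roots _ _ (λ _ → refl) h) elems)
                            (cong (q ℕ.*_) (affine-roots _ _ b (λ _ → refl) b≢0)))
                     (cong₂ ℕ._+_ (no-roots _ _ (λ _ → refl) (λ h → b≢0 (trans (sym (at-p2 a b)) h)))
                                  (count-singleton-yes (orthogonal? (a , b , 0#)) p3 (at-p3 a b 0#))) ⟩
    q ℕ.* 1 ℕ.+ 1   ≡⟨ cong (ℕ._+ 1) (ℕ.*-identityʳ q) ⟩
    q ℕ.+ 1         ≡⟨ ℕ.+-comm q 1 ⟩
    suc q ∎
  ... | yes refl | yes refl = begin
    count (orthogonal? (a , 0# , 0#)) points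
      ≡⟨ count-points (orthogonal? (a , 0# , 0#)) ⟩
    _ ≡⟨ cong₂ ℕ._+_ (sum-elems-const _ 0 (λ y → no-roots _ _ (λ _ → refl) (λ h → a≢0 (trans (sym (at-p1 a y)) h))))
                     (cong₂ ℕ._+_ (constant-roots _ _ (λ _ → refl) (at-p2 a 0#))
                                  (count-singleton-yes (orthogonal? (a , 0# , 0#)) p3 (at-p3 a 0# 0#))) ⟩
    q ℕ.+ 1         ≡⟨ ℕ.+-comm q 1 ⟩
    suc q ∎
    where
    a≢0 : a ≢ 0#
    a≢0 a≡0 = nonzero (a≡0 , refl , refl)

  p1-injective : ∀ {a b c d} → p1 a b ≡ p1 c d → a ≡ c × b ≡ d
  p1-injective refl = refl , refl

  point-multiplicity : ∀ p → count (λ r → r ≟P p) points ≡ 1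
  point-multiplicity (p1 a b) = trans (count-points is-p) (cong₂ ℕ._+_
    (trans (sum-indicator (λ y → y ≟ a) (λ y → count (λ z → is-p (p1 y z)) elems) 1
              (λ { y refl → count-elems-unique (λ z → is-p (p1 a z)) b (λ z eq → proj₂ (p1-injective eq)) refl })
              (λ y y≢a → count-none (λ z → is-p (p1 y z)) (λ z eq → y≢a (proj₁ (p1-injective eq))) elems) elems)
           (cong (1 ℕ.*_) (count-elems-unique (λ y → y ≟ a) a (λ y eq → eq) refl)))
    (cong₂ ℕ._+_ (count-none (λ z → is-p (p2 z)) (λ z ()) elems) (count-singleton-no is-p p3 (λ ()))))
    where
    is-p : ∀ r → Dec (r ≡ p1 a b)
    is-p r = r ≟P p1 a b
  point-multiplicity (p2 c) = trans (count-points is-p) (cong₂ ℕ._+_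
    (sum-elems-const _ 0 (λ y → count-none (λ z → is-p (p1 y z)) (λ z ()) elems))
    (cong₂ ℕ._+_ (count-elems-unique (λ z → is-p (p2 z)) c (λ { z refl → refl }) refl) (count-singleton-no is-p p3 (λ ()))))
    where
    is-p : ∀ r → Dec (r ≡ p2 c)
    is-p r = r ≟P p2 c
  point-multiplicity p3 = trans (count-points is-p) (cong₂ ℕ._+_
    (sum-elems-const _ 0 (λ y → count-none (λ z → is-p (p1 y z)) (λ z ()) elems))
    (cong₂ ℕ._+_ (count-none (λ z → is-p (p2 z)) (λ z ()) elems) (count-singleton-yes is-p p3 refl)))
    where
    is-p : ∀ r → Dec (r ≡ p3)
    is-p r = r ≟P p3

  coords-nonzero : ∀ p → Nonzero (coords p)
  coords-nonzero (p1 _ _) (1≡0 , _) = 1≢0 1≡0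
  coords-nonzero (p2 _) (_ , 1≡0 , _) = 1≢0 1≡0
  coords-nonzero p3 (_ , _ , 1≡0) = 1≢0 1≡0

  polar-size : ∀ p → count (λ r → dot p r ≟ 0#) points ≡ suc q
  polar-size p = line-size (coords p) (coords-nonzero p)

  -- The polar line of p consists of p itself (if p is absolute) and the H-neighbours of p.
  polar-split : ∀ p → count (λ r → dot p r ≟ 0#) points
                      ≡ count (λ r → (r ≟P p) ×-dec (dot p r ≟ 0#)) points ℕ.+ degree H p
  polar-split p = trans (count-split (λ r → dot p r ≟ 0#) (λ r → r ≟P p) points)
    (cong (count (λ r → (r ≟P p) ×-dec (dot p r ≟ 0#)) points ℕ.+_)
      (count-≐ (λ r → ¬? (r ≟P p) ×-dec (dot p r ≟ 0#)) (HAdj? p)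
               (λ r (r≢p , d) → (λ eq → r≢p (sym eq)) , d)
               (λ r (p≢r , d) → (λ eq → p≢r (sym eq)) , d) points))

  -- An absolute point has degree q in H (its polar line minus itself).
  degree-absolute : ∀ p → dot p p ≡ 0# → degree H p ≡ q
  degree-absolute p pp≡0 = ℕ.suc-injective (begin
    suc (degree H p)
      ≡⟨ cong (ℕ._+ degree H p) (sym self) ⟩
    count (λ r → (r ≟P p) ×-dec (dot p r ≟ 0#)) points ℕ.+ degree H p
      ≡⟨ sym (polar-split p) ⟩
    count (λ r → dot p r ≟ 0#) points
      ≡⟨ polar-size p ⟩
    suc q ∎)
    where
    self : count (λ r → (r ≟P p) ×-dec (dot p r ≟ 0#)) points ≡ 1
    self = trans (count-≐ _ (λ r → r ≟P p) (λ r → proj₁) (λ { r refl → refl , pp≡0 }) points) (point-multiplicity p)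

  degree-non-absolute : ∀ p → dot p p ≢ 0# → degree H p ≡ suc q
  degree-non-absolute p pp≢0 = begin
    degree H p
      ≡⟨ cong (ℕ._+ degree H p) (sym self) ⟩
    count (λ r → (r ≟P p) ×-dec (dot p r ≟ 0#)) points ℕ.+ degree H p
      ≡⟨ sym (polar-split p) ⟩
    count (λ r → dot p r ≟ 0#) points
      ≡⟨ polar-size p ⟩
    suc q ∎
    where
    self : count (λ r → (r ≟P p) ×-dec (dot p r ≟ 0#)) points ≡ 0
    self = count-none _ (λ { r (refl , pp≡0) → pp≢0 pp≡0 }) points

  Code : Set
  Code = Fin 2 ⊎ (Fin q ⊎ (Fin q × Fin q))

  vertex-code : Code → Maybe Point
  vertex-code (inj₁ zero) = nothing
  vertex-code (inj₁ (suc _)) = just p3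
  vertex-code (inj₂ (inj₁ c)) = just (p2 (to c))
  vertex-code (inj₂ (inj₂ (a , b))) = just (p1 (to a) (to b))

  vertex-decode : Maybe Point → Code
  vertex-decode nothing = inj₁ zero
  vertex-decode (just p3) = inj₁ (suc zero)
  vertex-decode (just (p2 c)) = inj₂ (inj₁ (from c))
  vertex-decode (just (p1 a b)) = inj₂ (inj₂ (from a , from b))

  decode-code : ∀ x → vertex-decode (vertex-code x) ≡ x
  decode-code (inj₁ zero) = refl
  decode-code (inj₁ (suc zero)) = refl
  decode-code (inj₂ (inj₁ c)) = cong (λ i → inj₂ (inj₁ i)) (strictlyInverseʳ c)
  decode-code (inj₂ (inj₂ (a , b))) = cong₂ (λ i j → inj₂ (inj₂ (i , j))) (strictlyInverseʳ a) (strictlyInverseʳ b)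

  fin-split : Fin (2 ℕ.+ (q ℕ.+ q ℕ.* q)) ↔ Code
  fin-split = (↔-id (Fin 2) ⊎-↔ ((↔-id (Fin q) ⊎-↔ *↔×) ↔-∘ +↔⊎)) ↔-∘ +↔⊎

  vertex-enumeration : Fin (2 ℕ.+ (q ℕ.+ q ℕ.* q)) → Maybe Point
  vertex-enumeration i = vertex-code (Inverse.to fin-split i)

  vertex-enumeration-injective : ∀ {i j} → vertex-enumeration i ≡ vertex-enumeration j → i ≡ j
  vertex-enumeration-injective {i} {j} same = Injection.injective (↔⇒↣ fin-split) (begin
    Inverse.to fin-split i                                 ≡⟨ sym (decode-code _) ⟩
    vertex-decode (vertex-code (Inverse.to fin-split i))   ≡⟨ cong vertex-decode same ⟩
    vertex-decode (vertex-code (Inverse.to fin-split j))   ≡⟨ decode-code _ ⟩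
    Inverse.to fin-split j ∎)

module EvenPlane (F : Field) (q : ℕ) (e : Fin q ↔ Field.Carrier F)
                 (char2 : Field._+_ F (Field.1# F) (Field.1# F) ≡ Field.0# F) where
  import Data.Nat as ℕ
  import Data.Nat.Properties as ℕ
  open import Data.List using ([]; _∷_; map)
  open import Data.Maybe using (just; nothing)
  open import Data.Product using (_×_; _,_; proj₁; proj₂; Σ; ∃)
  open import Data.Sum using (_⊎_; inj₁; inj₂)
  import Data.Sum
  open import Data.Empty using (⊥-elim)
  open import Relation.Nullary using (¬_; Dec; yes; no)
  open import Relation.Binary.PropositionalEquality
  open import Function using (_∘_)

  open Plane F q e public
  open Counting
  open ≡-Reasoning

  x+x≡0 : ∀ x → x + x ≡ 0#
  x+x≡0 x = begin
    x + x               ≡⟨ sym (cong₂ _+_ (*-identityˡ x) (*-identityˡ x)) ⟩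
    1# * x + 1# * x     ≡⟨ sym (distribʳ x 1# 1#) ⟩
    (1# + 1#) * x       ≡⟨ cong (_* x) char2 ⟩
    0# * x              ≡⟨ zeroˡ x ⟩
    0# ∎

  +≡0⇒≡ : ∀ {a b} → a + b ≡ 0# → a ≡ b
  +≡0⇒≡ {a} {b} a+b≡0 = trans (+-inverseʳ-unique a a (x+x≡0 a)) (sym (+-inverseʳ-unique a b a+b≡0))

  +-twice : ∀ a t → a + (t + t) ≡ a
  +-twice a t = trans (cong (a +_) (x+x≡0 t)) (+-identityʳ a)

  u v s : Vec3 → Carrier
  u (x , y , z) = x + z
  v (x , y , z) = y + z
  s (x , y , z) = (x + y) + z

  ·-invariant : ∀ X Y → X · Y ≡ s X * s Y + (u X * v Y + v X * u Y)
  ·-invariant (x , y , z) (x' , y' , z') = sym (trans (expand x y z x' y' z') (+-twice _ _))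
    where
    expand : ∀ x y z x' y' z' →
      ((x + y) + z) * ((x' + y') + z') + ((x + z) * (y' + z') + (y + z) * (x' + z'))
      ≡ ((x * x' + y * y') + z * z')
        + ((x * y' + x * z' + y * x' + y * z' + z * x' + z * y' + z * z')
           + (x * y' + x * z' + y * x' + y * z' + z * x' + z * y' + z * z'))
    expand = solve 6 (λ x y z x' y' z' →
      ((x :+ y) :+ z) :* ((x' :+ y') :+ z') :+ ((x :+ z) :* (y' :+ z') :+ (y :+ z) :* (x' :+ z'))
      := ((x :* x' :+ y :* y') :+ z :* z')
         :+ ((x :* y' :+ x :* z' :+ y :* x' :+ y :* z' :+ z :* x' :+ z :* y' :+ z :* z')
            :+ (x :* y' :+ x :* z' :+ y :* x' :+ y :* z' :+ z :* x' :+ z :* y' :+ z :* z'))) refl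

  x-from-invariants : ∀ x y z → x ≡ s (x , y , z) + v (x , y , z)
  x-from-invariants x y z = sym (trans
    (solve 3 (λ x y z → ((x :+ y) :+ z) :+ (y :+ z) := x :+ ((y :+ z) :+ (y :+ z))) refl x y z)
    (+-twice x _))

  y-from-invariants : ∀ x y z → y ≡ s (x , y , z) + u (x , y , z)
  y-from-invariants x y z = sym (trans
    (solve 3 (λ x y z → ((x :+ y) :+ z) :+ (x :+ z) := y :+ ((x :+ z) :+ (x :+ z))) refl x y z)
    (+-twice y _))

  z-from-invariants : ∀ x y z → z ≡ s (x , y , z) + u (x , y , z) + v (x , y , z)
  z-from-invariants x y z = sym (trans
    (solve 3 (λ x y z → ((x :+ y) :+ z) :+ (x :+ z) :+ (y :+ z) := z :+ (((x :+ y) :+ z) :+ ((x :+ y) :+ z))) refl x y z)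
    (+-twice z _))

  infixr 8 _⋆_
  _⋆_ : Carrier → Vec3 → Vec3
  m ⋆ (x , y , z) = (m * x , m * y , m * z)

  invariants-proportional : ∀ X Y m → u X ≡ m * u Y → v X ≡ m * v Y → s X ≡ m * s Y → X ≡ m ⋆ Y
  invariants-proportional (x , y , z) (x' , y' , z') m hu hv hs = cong₂ _,_ x-eq (cong₂ _,_ y-eq z-eq)
    where
    X Y : Vec3
    X = (x , y , z)
    Y = (x' , y' , z')
    x-eq : x ≡ m * x'
    x-eq = begin
      x                       ≡⟨ x-from-invariants x y z ⟩
      s X + v X               ≡⟨ cong₂ _+_ hs hv ⟩
      m * s Y + m * v Y       ≡⟨ sym (distribˡ m (s Y) (v Y)) ⟩
      m * (s Y + v Y)         ≡⟨ cong (m *_) (sym (x-from-invariants x' y' z')) ⟩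
      m * x' ∎
    y-eq : y ≡ m * y'
    y-eq = begin
      y                       ≡⟨ y-from-invariants x y z ⟩
      s X + u X               ≡⟨ cong₂ _+_ hs hu ⟩
      m * s Y + m * u Y       ≡⟨ sym (distribˡ m (s Y) (u Y)) ⟩
      m * (s Y + u Y)         ≡⟨ cong (m *_) (sym (y-from-invariants x' y' z')) ⟩
      m * y' ∎
    z-eq : z ≡ m * z'
    z-eq = begin
      z                               ≡⟨ z-from-invariants x y z ⟩
      s X + u X + v X                 ≡⟨ cong₂ _+_ (cong₂ _+_ hs hu) hv ⟩
      m * s Y + m * u Y + m * v Y     ≡⟨ cong (_+ m * v Y) (sym (distribˡ m (s Y) (u Y))) ⟩
      m * (s Y + u Y) + m * v Y       ≡⟨ sym (distribˡ m (s Y + u Y) (v Y)) ⟩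
      m * (s Y + u Y + v Y)           ≡⟨ cong (m *_) (sym (z-from-invariants x' y' z')) ⟩
      m * z' ∎

  -- Normalised representatives with proportional coordinates are equal: the
  -- leading coordinate 1 forces the scalar to be 1.
  proportional-points : ∀ p r m → coords p ≡ m ⋆ coords r → p ≡ r
  proportional-points p r m eq =
    same-point p r (cong proj₁ eq) (cong (proj₁ ∘ proj₂) eq) (cong (proj₂ ∘ proj₂) eq)
    where
    scalar : ∀ {c} → c ≡ m * 1# → m ≡ c
    scalar c≡m = trans (sym (*-identityʳ m)) (sym c≡m)
    1≢m0 : ¬ (1# ≡ m * 0#)
    1≢m0 1≡m0 = 1≢0 (trans 1≡m0 (zeroʳ m))
    1≢0c : ∀ c → 0# ≡ m * 1# → ¬ (1# ≡ m * c)
    1≢0c c 0≡m 1≡mc = 1≢0 (trans 1≡mc (trans (cong (_* c) (scalar 0≡m)) (zeroˡ c)))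
    same-point : ∀ p′ r′ → proj₁ (coords p′) ≡ m * proj₁ (coords r′)
      → proj₁ (proj₂ (coords p′)) ≡ m * proj₁ (proj₂ (coords r′))
      → proj₂ (proj₂ (coords p′)) ≡ m * proj₂ (proj₂ (coords r′)) → p′ ≡ r′
    same-point (p1 a b) (p1 c d) hx hy hz =
      cong₂ p1 (trans hy (trans (cong (_* c) (scalar hx)) (*-identityˡ c)))
               (trans hz (trans (cong (_* d) (scalar hx)) (*-identityˡ d)))
    same-point (p1 _ _) (p2 _) hx _ _ = ⊥-elim (1≢m0 hx)
    same-point (p1 _ _) p3 hx _ _ = ⊥-elim (1≢m0 hx)
    same-point (p2 _) (p1 c _) hx hy _ = ⊥-elim (1≢0c c hx hy)
    same-point (p2 a) (p2 c) _ hy hz = cong p2 (trans hz (trans (cong (_* c) (scalar hy)) (*-identityˡ c)))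
    same-point (p2 _) p3 _ hy _ = ⊥-elim (1≢m0 hy)
    same-point p3 (p1 _ d) hx _ hz = ⊥-elim (1≢0c d hx hz)
    same-point p3 (p2 c) _ hy hz = ⊥-elim (1≢0c c hy hz)
    same-point p3 p3 _ _ _ = refl

  -- Invariant coordinates of points; W is the part of the form not involving s.
  U V S : Point → Carrier
  U p = u (coords p)
  V p = v (coords p)
  S p = s (coords p)

  W : Point → Point → Carrier
  W p r = U p * V r + V p * U r

  dot-invariant : ∀ p r → dot p r ≡ S p * S r + W p r
  dot-invariant p r = ·-invariant (coords p) (coords r)

  invariants-determine : ∀ p r m → U p ≡ m * U r → V p ≡ m * V r → S p ≡ m * S r → p ≡ r
  invariants-determine p r m hu hv hs =
    proportional-points p r m (invariants-proportional (coords p) (coords r) m hu hv hs)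

  -- The nucleus N = (1,1,1): its polar line s = 0 carries all absolute points.
  nucleus : Point
  nucleus = p1 1# 1#

  U-nucleus : U nucleus ≡ 0#
  U-nucleus = char2

  V-nucleus : V nucleus ≡ 0#
  V-nucleus = char2

  S-nucleus : S nucleus ≡ 1#
  S-nucleus = trans (cong (_+ 1#) char2) (+-identityˡ 1#)

  dot-nucleus : ∀ r → dot nucleus r ≡ S r
  dot-nucleus r = cong₂ _+_ (cong₂ _+_ (*-identityˡ _) (*-identityˡ _)) (*-identityˡ _)

  nucleus-unique : ∀ p → U p ≡ 0# → V p ≡ 0# → p ≡ nucleus
  nucleus-unique p u≡0 v≡0 = invariants-determine p nucleus (S p)
    (trans u≡0 (sym (trans (cong (S p *_) U-nucleus) (zeroʳ (S p)))))
    (trans v≡0 (sym (trans (cong (S p *_) V-nucleus) (zeroʳ (S p)))))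
    (sym (trans (cong (S p *_) S-nucleus) (*-identityʳ (S p))))

  -- dot p p = s(p)², as W p p = 2 u(p) v(p) = 0.
  self-dot : ∀ p → dot p p ≡ S p * S p
  self-dot p = begin
    dot p p                            ≡⟨ dot-invariant p p ⟩
    S p * S p + (U p * V p + V p * U p) ≡⟨ cong (λ t → S p * S p + (U p * V p + t)) (*-comm (V p) (U p)) ⟩
    S p * S p + (U p * V p + U p * V p) ≡⟨ +-twice (S p * S p) (U p * V p) ⟩
    S p * S p ∎

  absolute⇒S≡0 : ∀ p → dot p p ≡ 0# → S p ≡ 0#
  absolute⇒S≡0 p pp≡0 = square-zero (trans (sym (self-dot p)) pp≡0)

  S≡0⇒absolute : ∀ p → S p ≡ 0# → dot p p ≡ 0#
  S≡0⇒absolute p S≡0 = trans (self-dot p) (trans (cong (_* S p) S≡0) (zeroˡ (S p)))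

  joined-to-new⇒S≡0 : ∀ r → degree H r ≡ q → S r ≡ 0#
  joined-to-new⇒S≡0 r deg≡q = by-absoluteness (dot r r ≟ 0#)
    where
    by-absoluteness : Dec (dot r r ≡ 0#) → S r ≡ 0#
    by-absoluteness (yes rr≡0) = absolute⇒S≡0 r rr≡0
    by-absoluteness (no rr≢0) = ⊥-elim (ℕ.1+n≢n (trans (sym (degree-non-absolute r rr≢0)) deg≡q))

  S≡0⇒joined-to-new : ∀ r → S r ≡ 0# → degree H r ≡ q
  S≡0⇒joined-to-new r S≡0 = degree-absolute r (S≡0⇒absolute r S≡0)

  -- The new vertex has degree q + 1: its neighbours are the points of the polar of N.
  new-vertex-degree : count (λ r → degree H r ℕ.≟ q) points ≡ suc q
  new-vertex-degree = trans
    (count-≐ (λ r → degree H r ℕ.≟ q) (λ r → dot nucleus r ≟ 0#)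
             (λ r deg≡q → trans (dot-nucleus r) (joined-to-new⇒S≡0 r deg≡q))
             (λ r Nr≡0 → S≡0⇒joined-to-new r (trans (sym (dot-nucleus r)) Nr≡0)) points)
    (polar-size nucleus)

  -- H̃ is (q + 1)-regular: a point gains the new vertex as a neighbour exactly
  -- when it is absolute, i.e. when its degree in H is q.
  regular : Regular Htilde (q ℕ.+ 1)
  regular (just p) = begin
    degree Htilde (just p)
      ≡⟨ count-++ (TAdj? (just p)) (nothing ∷ []) (map just points) ⟩
    count (TAdj? (just p)) (nothing ∷ []) ℕ.+ count (TAdj? (just p)) (map just points)
      ≡⟨ cong (count (TAdj? (just p)) (nothing ∷ []) ℕ.+_) (count-map (TAdj? (just p)) just points) ⟩
    count (TAdj? (just p)) (nothing ∷ []) ℕ.+ degree H p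
      ≡⟨ by-absoluteness (dot p p ≟ 0#) ⟩
    q ℕ.+ 1 ∎
    where
    by-absoluteness : Dec (dot p p ≡ 0#) → count (TAdj? (just p)) (nothing ∷ []) ℕ.+ degree H p ≡ q ℕ.+ 1
    by-absoluteness (yes pp≡0) = trans
      (cong₂ ℕ._+_ (count-singleton-yes (TAdj? (just p)) nothing (degree-absolute p pp≡0)) (degree-absolute p pp≡0))
      (ℕ.+-comm 1 q)
    by-absoluteness (no pp≢0) = trans
      (cong₂ ℕ._+_ (count-singleton-no (TAdj? (just p)) nothing
                      (λ deg≡q → ℕ.1+n≢n (trans (sym (degree-non-absolute p pp≢0)) deg≡q)))
                   (degree-non-absolute p pp≢0))
      (ℕ.+-comm 1 q)
  regular nothing = trans (count-map (TAdj? nothing) just points) (trans new-vertex-degree (ℕ.+-comm 1 q))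

  -- The cross product (in characteristic two, without signs) is orthogonal to both factors.
  cross : Vec3 → Vec3 → Vec3
  cross (x , y , z) (x' , y' , z') = (y * z' + z * y' , z * x' + x * z' , x * y' + y * x')

  cross-orthogonalˡ : ∀ X Y → X · cross X Y ≡ 0#
  cross-orthogonalˡ (x , y , z) (x' , y' , z') = trans (twice x y z x' y' z') (x+x≡0 _)
    where
    twice : ∀ x y z x' y' z' → (x * (y * z' + z * y') + y * (z * x' + x * z')) + z * (x * y' + y * x')
                               ≡ (x * y * z' + x * z * y' + y * z * x') + (x * y * z' + x * z * y' + y * z * x')
    twice = solve 6 (λ x y z x' y' z' →
      (x :* (y :* z' :+ z :* y') :+ y :* (z :* x' :+ x :* z')) :+ z :* (x :* y' :+ y :* x')
      := (x :* y :* z' :+ x :* z :* y' :+ y :* z :* x') :+ (x :* y :* z' :+ x :* z :* y' :+ y :* z :* x')) refl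

  cross-orthogonalʳ : ∀ X Y → Y · cross X Y ≡ 0#
  cross-orthogonalʳ (x , y , z) (x' , y' , z') = trans (twice x y z x' y' z') (x+x≡0 _)
    where
    twice : ∀ x y z x' y' z' → (x' * (y * z' + z * y') + y' * (z * x' + x * z')) + z' * (x * y' + y * x')
                               ≡ (x' * y * z' + x' * z * y' + y' * x * z') + (x' * y * z' + x' * z * y' + y' * x * z')
    twice = solve 6 (λ x y z x' y' z' →
      (x' :* (y :* z' :+ z :* y') :+ y' :* (z :* x' :+ x :* z')) :+ z' :* (x :* y' :+ y :* x')
      := (x' :* y :* z' :+ x' :* z :* y' :+ y' :* x :* z') :+ (x' :* y :* z' :+ x' :* z :* y' :+ y' :* x :* z')) refl

  cross-nonzero : ∀ p r → p ≢ r → Nonzero (cross (coords p) (coords r))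
  cross-nonzero (p1 a b) (p1 c d) p≢r (_ , hy , hz) = p≢r (cong₂ p1
    (sym (+≡0⇒≡ (trans (cong₂ _+_ (sym (*-identityˡ c)) (sym (*-identityʳ a))) hz)))
    (+≡0⇒≡ (trans (cong₂ _+_ (sym (*-identityʳ b)) (sym (*-identityˡ d))) hy)))
  cross-nonzero (p1 a _) (p2 _) _ (_ , _ , hz) = 1≢0 (trans (sym (one-plus-zero (*-identityˡ 1#) (zeroʳ a))) hz)
  cross-nonzero (p1 _ b) p3 _ (_ , hy , _) = 1≢0 (trans (sym (zero-plus-one (zeroʳ b) (*-identityˡ 1#))) hy)
  cross-nonzero (p2 _) (p1 a _) _ (_ , _ , hz) = 1≢0 (trans (sym (zero-plus-one (zeroˡ a) (*-identityˡ 1#))) hz)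
  cross-nonzero (p2 c) (p2 d) p≢r (hx , _ , _) =
    p≢r (cong p2 (sym (+≡0⇒≡ (trans (cong₂ _+_ (sym (*-identityˡ d)) (sym (*-identityʳ c))) hx))))
  cross-nonzero (p2 c) p3 _ (hx , _ , _) = 1≢0 (trans (sym (one-plus-zero (*-identityˡ 1#) (zeroʳ c))) hx)
  cross-nonzero p3 (p1 _ b) _ (_ , hy , _) = 1≢0 (trans (sym (one-plus-zero (*-identityˡ 1#) (zeroˡ b))) hy)
  cross-nonzero p3 (p2 c) _ (hx , _ , _) = 1≢0 (trans (sym (zero-plus-one (zeroˡ c) (*-identityˡ 1#))) hx)
  cross-nonzero p3 p3 p≢r _ = p≢r refl

  normalise : Vec3 → Point
  normalise (x , y , z) with x ≟ 0#
  ... | no _ = p1 (y * inv x) (z * inv x)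
  ... | yes _ with y ≟ 0#
  ...   | no _ = p2 (z * inv y)
  ...   | yes _ = p3

  normalise-scales : ∀ X → Nonzero X → Σ Carrier λ m → coords (normalise X) ≡ m ⋆ X
  normalise-scales (x , y , z) nonzero with x ≟ 0#
  ... | no x≢0 = inv x , cong₂ _,_ (sym (*-inverseˡ x x≢0)) (cong₂ _,_ (*-comm y (inv x)) (*-comm z (inv x)))
  ... | yes x≡0 with y ≟ 0#
  ...   | no y≢0 = inv y ,
            cong₂ _,_ (sym (trans (cong (inv y *_) x≡0) (zeroʳ (inv y)))) (cong₂ _,_ (sym (*-inverseˡ y y≢0)) (*-comm z (inv y)))
  ...   | yes y≡0 = inv z ,
            cong₂ _,_ (sym (trans (cong (inv z *_) x≡0) (zeroʳ (inv z))))
                      (cong₂ _,_ (sym (trans (cong (inv z *_) y≡0) (zeroʳ (inv z)))) (sym (*-inverseˡ z z≢0)))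
    where
    z≢0 : z ≢ 0#
    z≢0 z≡0 = nonzero (x≡0 , y≡0 , z≡0)

  ⋆-· : ∀ m X Y → (m ⋆ X) · Y ≡ m * (X · Y)
  ⋆-· m (x , y , z) (x' , y' , z') = solve 7 (λ m x y z x' y' z' →
    (m :* x :* x' :+ m :* y :* y') :+ m :* z :* z' := m :* ((x :* x' :+ y :* y') :+ z :* z')) refl m x y z x' y' z'

  normalise-orthogonal : ∀ X r → Nonzero X → X · coords r ≡ 0# → dot (normalise X) r ≡ 0#
  normalise-orthogonal X r nonzero X·r≡0 with normalise-scales X nonzero
  ... | m , coords≡ = begin
    coords (normalise X) · coords r   ≡⟨ cong (_· coords r) coords≡ ⟩
    (m ⋆ X) · coords r                ≡⟨ ⋆-· m X (coords r) ⟩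
    m * (X · coords r)                ≡⟨ cong (m *_) X·r≡0 ⟩
    m * 0#                            ≡⟨ zeroʳ m ⟩
    0# ∎

  common-orthogonal : ∀ p r → p ≢ r → Σ Point λ w → dot w p ≡ 0# × dot w r ≡ 0#
  common-orthogonal p r p≢r = normalise X ,
    normalise-orthogonal X p (cross-nonzero p r p≢r) (trans (·-comm X (coords p)) (cross-orthogonalˡ (coords p) (coords r))) ,
    normalise-orthogonal X r (cross-nonzero p r p≢r) (trans (·-comm X (coords r)) (cross-orthogonalʳ (coords p) (coords r)))
    where
    X : Vec3
    X = cross (coords p) (coords r)

  -- The absolute point A = (0,1,1), used as a common neighbour of N and the new vertex.
  absolute-point : Point
  absolute-point = p2 1#

  S-absolute-point : S absolute-point ≡ 0#
  S-absolute-point = trans (cong (_+ 1#) (+-identityˡ 1#)) char2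

  nucleus-adj-absolute-point : HAdj nucleus absolute-point
  nucleus-adj-absolute-point = (λ ()) , trans (dot-nucleus absolute-point) S-absolute-point

  TAdj-sym : ∀ a b → TAdj a b → TAdj b a
  TAdj-sym (just p) (just r) (p≢r , pr≡0) = (λ r≡p → p≢r (sym r≡p)) , trans (dot-comm r p) pr≡0
  TAdj-sym (just p) nothing joined = joined
  TAdj-sym nothing (just r) joined = joined

  points-within-two : ∀ p r → p ≢ r → HAdj p r ⊎ Σ Point λ w → HAdj p w × HAdj w r
  points-within-two p r p≢r = by-orthogonality (dot p r ≟ 0#)
    where
    w : Point
    w = proj₁ (common-orthogonal p r p≢r)
    wp≡0 : dot w p ≡ 0#
    wp≡0 = proj₁ (proj₂ (common-orthogonal p r p≢r))
    wr≡0 : dot w r ≡ 0#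
    wr≡0 = proj₂ (proj₂ (common-orthogonal p r p≢r))
    by-orthogonality : Dec (dot p r ≡ 0#) → HAdj p r ⊎ Σ Point λ w → HAdj p w × HAdj w r
    by-orthogonality (yes pr≡0) = inj₁ (p≢r , pr≡0)
    by-orthogonality (no pr≢0) = inj₂ (w , (p≢w , trans (dot-comm p w) wp≡0) , (w≢r , wr≡0))
      where
      p≢w : p ≢ w
      p≢w p≡w = pr≢0 (trans (cong (λ t → dot t r) p≡w) wr≡0)
      w≢r : w ≢ r
      w≢r w≡r = pr≢0 (trans (dot-comm p r) (trans (cong (λ t → dot t p) (sym w≡r)) wp≡0))

  -- Every point is joined to the new vertex directly or through a point with s = 0
  -- (A for the nucleus, a common orthogonal point of r and N otherwise).
  new-vertex-within-two : ∀ r → TAdj nothing (just r) ⊎ ∃ λ w → TAdj nothing w × TAdj w (just r)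
  new-vertex-within-two r = by-S (S r ≟ 0#)
    where
    via : ∀ w → S w ≡ 0# → HAdj w r → ∃ λ w → TAdj nothing w × TAdj w (just r)
    via w Sw≡0 wr = just w , S≡0⇒joined-to-new w Sw≡0 , wr
    by-nucleus : S r ≢ 0# → Dec (r ≡ nucleus) → ∃ λ w → TAdj nothing w × TAdj w (just r)
    by-nucleus _ (yes refl) = via absolute-point S-absolute-point
      (TAdj-sym (just nucleus) (just absolute-point) nucleus-adj-absolute-point)
    by-nucleus S≢0 (no r≢N) = via w Sw≡0 (w≢r , wr≡0)
      where
      w : Point
      w = proj₁ (common-orthogonal r nucleus r≢N)
      wr≡0 : dot w r ≡ 0#
      wr≡0 = proj₁ (proj₂ (common-orthogonal r nucleus r≢N))
      Sw≡0 : S w ≡ 0#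
      Sw≡0 = trans (sym (dot-nucleus w)) (trans (dot-comm nucleus w) (proj₂ (proj₂ (common-orthogonal r nucleus r≢N))))
      w≢r : w ≢ r
      w≢r w≡r = S≢0 (trans (cong S (sym w≡r)) Sw≡0)
    by-S : Dec (S r ≡ 0#) → TAdj nothing (just r) ⊎ ∃ λ w → TAdj nothing w × TAdj w (just r)
    by-S (yes S≡0) = inj₁ (S≡0⇒joined-to-new r S≡0)
    by-S (no S≢0) = inj₂ (by-nucleus S≢0 (r ≟P nucleus))

  within-two : ∀ a b → a ≢ b → TAdj a b ⊎ ∃ λ w → TAdj a w × TAdj w b
  within-two (just p) (just r) a≢b =
    Data.Sum.map₂ (λ { (w , pw , wr) → just w , pw , wr }) (points-within-two p r (λ p≡r → a≢b (cong just p≡r)))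
  within-two nothing (just r) _ = new-vertex-within-two r
  within-two (just p) nothing _ =
    Data.Sum.map₂ (λ { (w , nw , wp) → w , TAdj-sym w (just p) wp , TAdj-sym nothing w nw }) (new-vertex-within-two p)
  within-two nothing nothing a≢b = ⊥-elim (a≢b refl)

  -- H̃ has diameter two; N and the new vertex are at distance two.
  diameter-two : Diameter2 Htilde
  diameter-two = within-two , just nucleus , nothing , (λ ()) , nucleus-not-joined ,
                 just absolute-point , nucleus-adj-absolute-point , S≡0⇒joined-to-new absolute-point S-absolute-point
    where
    nucleus-not-joined : ¬ TAdj (just nucleus) nothing
    nucleus-not-joined deg≡q = 1≢0 (trans (sym S-nucleus) (joined-to-new⇒S≡0 nucleus deg≡q))

module BlockArithmetic (q : ℕ) .{{_ : NonZero q}} where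
  open import Data.Nat using (_+_; _*_; _<_; _<?_)
  open import Data.Nat.Properties using (+-cancelˡ-≡; *-cancelʳ-≡; ≤-antisym; ≮⇒≥; m<n⇒0<n)
  open import Data.Nat.DivMod using (_%_; [m+kn]%n≡m%n; m<n⇒m%n≡m)
  open import Data.Product using (_×_; _,_)
  open import Data.Sum using (_⊎_; inj₁; inj₂)
  open import Relation.Nullary using (yes; no)
  open import Relation.Binary.PropositionalEquality
  open ≡-Reasoning

  -- Slot and block are the remainder and quotient of s + b·q.
  slot-block-unique : ∀ {s s'} b b' → s < q → s' < q → s + b * q ≡ s' + b' * q → s ≡ s' × b ≡ b'
  slot-block-unique {s} {s'} b b' s<q s'<q eq = s≡s' , *-cancelʳ-≡ b b' q (+-cancelˡ-≡ s (b * q) (b' * q) eq′)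
    where
    s≡s' : s ≡ s'
    s≡s' = begin
      s                   ≡⟨ sym (m<n⇒m%n≡m s<q) ⟩
      s % q               ≡⟨ sym ([m+kn]%n≡m%n s b q) ⟩
      (s + b * q) % q     ≡⟨ cong (_% q) eq ⟩
      (s' + b' * q) % q   ≡⟨ [m+kn]%n≡m%n s' b' q ⟩
      s' % q              ≡⟨ m<n⇒m%n≡m s'<q ⟩
      s' ∎
    eq′ : s + b * q ≡ s + b' * q
    eq′ = trans eq (cong (_+ b' * q) (sym s≡s'))

  slot-block-successor : ∀ {s s'} b b' → s < q → s' < q → suc (s + b * q) ≡ s' + b' * q →
    (suc s ≡ s' × b ≡ b') ⊎ (suc s ≡ q × 0 ≡ s' × suc b ≡ b')
  slot-block-successor {s} {s'} b b' s<q s'<q eq with suc s <? q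
  ... | yes 1+s<q = inj₁ (slot-block-unique b b' 1+s<q s'<q eq)
  ... | no 1+s≮q = inj₂ (1+s≡q , slot-block-unique (suc b) b' (m<n⇒0<n s<q) s'<q next-block)
    where
    1+s≡q : suc s ≡ q
    1+s≡q = ≤-antisym s<q (≮⇒≥ 1+s≮q)
    -- suc (s + b·q) = q + b·q = 0 + (b + 1)·q
    next-block : 0 + suc b * q ≡ s' + b' * q
    next-block = trans (cong (_+ b * q) (sym 1+s≡q)) eq

module LabelDifferences where
  import Data.Nat as ℕ
  import Data.Nat.Properties as ℕ
  open import Data.Nat using (_<_; _∸_)
  open import Data.Integer using (ℤ; +_; ∣_∣; _-_; _+_; _≤_; +≤+; 0ℤ)
  import Data.Integer.Properties as ℤ
  open import Data.Empty using (⊥-elim)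
  open import Relation.Binary.Definitions using (tri<; tri≈; tri>)
  open import Relation.Binary.PropositionalEquality

  gap-two : ∀ {m n} → suc m < n → 2 ℕ.≤ ∣ + m - + n ∣
  gap-two {m} {n} 1+m<n = subst (2 ℕ.≤_) (sym distance) (subst (ℕ._≤ n ∸ m) (ℕ.m+n∸n≡m 2 m) (ℕ.∸-monoˡ-≤ m 1+m<n))
    where
    distance : ∣ + m - + n ∣ ≡ n ∸ m
    distance = trans (cong ∣_∣ (ℤ.m-n≡m⊖n m n)) (ℤ.∣⊖∣-< (ℕ.<-trans (ℕ.n<1+n m) 1+m<n))

  distance-two : ∀ m n → m ≢ n → suc m ≢ n → suc n ≢ m → 2 ℕ.≤ ∣ + m - + n ∣
  distance-two m n m≢n 1+m≢n 1+n≢m with ℕ.<-cmp m n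
  ... | tri< m<n _ _ = gap-two (ℕ.≤∧≢⇒< m<n 1+m≢n)
  ... | tri≈ _ m≡n _ = ⊥-elim (m≢n m≡n)
  ... | tri> _ _ n<m = subst (2 ℕ.≤_) (ℤ.∣i-j∣≡∣j-i∣ (+ n) (+ m)) (gap-two (ℕ.≤∧≢⇒< n<m 1+n≢m))

  difference≤ : ∀ {m M} n → m ℕ.≤ M → + m - + n ≤ + M
  difference≤ {m} n m≤M = ℤ.≤-trans (subst (_≤ + m) (sym (ℤ.m-n≡m⊖n m n)) (ℤ.m⊖n≤m m n)) (+≤+ m≤M)

  sub-antitone : ∀ a b x → a - x ≤ a - b → b ≤ x
  sub-antitone a b x a-x≤a-b = ℤ.i-j≤0⇒i≤j (subst₂ _≤_ (ℤ.+-minus-telescope b a x)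
    (trans (ℤ.+-minus-telescope b a b) (ℤ.+-inverseʳ b)) (ℤ.+-monoʳ-≤ (b - a) a-x≤a-b))

  sub-cancelʳ : ∀ a b c → a - c ≡ b - c → a ≡ b
  sub-cancelʳ a b c a-c≡b-c = ℤ.i-j≡0⇒i≡j a b (begin
    a - b                ≡⟨ sym (ℤ.+-minus-telescope a c b) ⟩
    (a - c) + (c - b)    ≡⟨ cong (_+ (c - b)) a-c≡b-c ⟩
    (b - c) + (c - b)    ≡⟨ ℤ.+-minus-telescope b c b ⟩
    b - b                ≡⟨ ℤ.+-inverseʳ b ⟩
    0ℤ ∎)
    where open ≡-Reasoning

module Labelling (F : Field) (q : ℕ) (e : Fin q ↔ Field.Carrier F)
                 (char2 : Field._+_ F (Field.1# F) (Field.1# F) ≡ Field.0# F) (2≤q : 2 ℕ.≤ q) where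
  import Data.Nat.Properties as ℕ
  open import Data.Nat using (_<_; _≤_; pred; z≤n; s≤s)
  open import Data.Fin using (toℕ; fromℕ<)
  import Data.Fin.Properties as Fin
  open import Data.Fin.Permutation.Components using (transpose; transpose-inverse)
  open import Data.Maybe using (Maybe; just; nothing)
  open import Data.Product using (_×_; _,_; proj₁; proj₂)
  open import Data.Sum using (inj₁; inj₂)
  open import Data.Empty using (⊥-elim)
  open import Relation.Nullary using (¬_; Dec; yes; no)
  open import Relation.Binary.PropositionalEquality
  open import Function.Bundles using (Inverse)

  open EvenPlane F q e char2 public
  open Inverse e using (to; from; strictlyInverseˡ)
  open ≡-Reasoning

  instance
    q-nonzero : NonZero q
    q-nonzero = ℕ.≢-nonZero (λ q≡0 → ℕ.<⇒≢ (ℕ.<-≤-trans (s≤s z≤n) 2≤q) (sym q≡0))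

  open BlockArithmetic q

  pred-q<q : pred q < q
  pred-q<q = subst (pred q <_) (ℕ.suc-pred q) (ℕ.n<1+n (pred q))

  pred-q≢0 : pred q ≢ 0
  pred-q≢0 pred≡0 = ℕ.<⇒≢ (ℕ.pred-mono-≤ 2≤q) (sym pred≡0)

  transpose-sends : ∀ {n} (i j : Fin n) → transpose i j i ≡ j
  transpose-sends i j with i Data.Fin.≟ i
  ... | yes _ = refl
  ... | no i≢i = ⊥-elim (i≢i refl)

  -- The enumeration of F with 0 swapped into the last position pred q.
  position : Carrier → Fin q
  position c = transpose (from 0#) (fromℕ< pred-q<q) (from c)

  rank : Carrier → ℕ
  rank c = toℕ (position c)

  rank<q : ∀ c → rank c < q
  rank<q c = Fin.toℕ<n (position c)

  rank-injective : ∀ {c c'} → rank c ≡ rank c' → c ≡ c'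
  rank-injective {c} {c'} rank≡ = begin
    c                    ≡⟨ sym (strictlyInverseˡ c) ⟩
    to (from c)          ≡⟨ cong to from≡ ⟩
    to (from c')         ≡⟨ strictlyInverseˡ c' ⟩
    c' ∎
    where
    position≡ : position c ≡ position c'
    position≡ = Fin.toℕ-injective rank≡
    from≡ : from c ≡ from c'
    from≡ = trans (sym (transpose-inverse _ _)) (trans (cong (transpose _ _) position≡) (transpose-inverse _ _))

  rank-zero : rank 0# ≡ pred q
  rank-zero = trans (cong toℕ (transpose-sends (from 0#) (fromℕ< pred-q<q))) (Fin.toℕ-fromℕ< pred-q<q)

  -- A point p ≠ N lies on the line of
  -- direction u(p) : v(p), numbered 0 .. q; its position on that line is
  -- its height s(p) / scale(p), which vanishes exactly at the absolute point.
  -- scale p is u(p), or v(p) when u(p) = 0; it is nonzero for p ≠ N.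
  scale : Point → Carrier
  scale p with U p ≟ 0#
  ... | yes _ = V p
  ... | no _ = U p

  direction-of : ∀ p → Dec (U p ≡ 0#) → ℕ
  direction-of p (yes _) = q
  direction-of p (no _) = rank (V p * inv (U p))

  direction : Point → ℕ
  direction p = direction-of p (U p ≟ 0#)

  height : Point → Carrier
  height p = S p * inv (scale p)

  scale-nonzero : ∀ p → p ≢ nucleus → scale p ≢ 0#
  scale-nonzero p p≢N with U p ≟ 0#
  ... | yes u≡0 = λ v≡0 → p≢N (nucleus-unique p u≡0 v≡0)
  ... | no u≢0 = u≢0

  direction≤q : ∀ p → direction p ≤ q
  direction≤q p with U p ≟ 0#
  ... | yes _ = ℕ.≤-refl
  ... | no _ = ℕ.<⇒≤ (rank<q _)

  same-direction⇒proportional : ∀ p r → p ≢ nucleus → r ≢ nucleus → direction p ≡ direction r →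
    (U p * inv (scale p) ≡ U r * inv (scale r)) × (V p * inv (scale p) ≡ V r * inv (scale r))
  same-direction⇒proportional p r p≢N r≢N same with U p ≟ 0# | U r ≟ 0#
  ... | yes up≡0 | yes ur≡0 =
    trans (cong (_* inv (V p)) up≡0) (trans (zeroˡ _) (sym (trans (cong (_* inv (V r)) ur≡0) (zeroˡ _)))) ,
    trans (*-inverseʳ (V p) (λ v≡0 → p≢N (nucleus-unique p up≡0 v≡0)))
          (sym (*-inverseʳ (V r) (λ v≡0 → r≢N (nucleus-unique r ur≡0 v≡0))))
  ... | yes _ | no _ = ⊥-elim (ℕ.<-irrefl (sym same) (rank<q _))
  ... | no _ | yes _ = ⊥-elim (ℕ.<-irrefl same (rank<q _))
  ... | no up≢0 | no ur≢0 = trans (*-inverseʳ (U p) up≢0) (sym (*-inverseʳ (U r) ur≢0)) , rank-injective same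

  ratio : Point → Point → Carrier
  ratio p r = scale p * inv (scale r)

  same-direction⇒scaled : ∀ p r → p ≢ nucleus → r ≢ nucleus → direction p ≡ direction r →
    (U p ≡ ratio p r * U r) × (V p ≡ ratio p r * V r)
  same-direction⇒scaled p r p≢N r≢N same-direction =
    rescale (scale-nonzero p p≢N) (proj₁ proportional) , rescale (scale-nonzero p p≢N) (proj₂ proportional)
    where
    proportional : (U p * inv (scale p) ≡ U r * inv (scale r)) × (V p * inv (scale p) ≡ V r * inv (scale r))
    proportional = same-direction⇒proportional p r p≢N r≢N same-direction

  direction-height-injective : ∀ p r → p ≢ nucleus → r ≢ nucleus →
    direction p ≡ direction r → height p ≡ height r → p ≡ r
  direction-height-injective p r p≢N r≢N same-direction same-height =
    invariants-determine p r (ratio p r) (proj₁ scaled) (proj₂ scaled) (rescale (scale-nonzero p p≢N) same-height)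
    where
    scaled : (U p ≡ ratio p r * U r) × (V p ≡ ratio p r * V r)
    scaled = same-direction⇒scaled p r p≢N r≢N same-direction

  same-direction⇒W≡0 : ∀ p r → p ≢ nucleus → r ≢ nucleus → direction p ≡ direction r → W p r ≡ 0#
  same-direction⇒W≡0 p r p≢N r≢N same-direction = begin
    U p * V r + V p * U r
      ≡⟨ cong₂ (λ a b → a * V r + b * U r) (proj₁ scaled) (proj₂ scaled) ⟩
    ratio p r * U r * V r + ratio p r * V r * U r
      ≡⟨ solve 3 (λ m a b → m :* a :* b :+ m :* b :* a := m :* a :* b :+ m :* a :* b) refl (ratio p r) (U r) (V r) ⟩
    ratio p r * U r * V r + ratio p r * U r * V r
      ≡⟨ x+x≡0 _ ⟩
    0# ∎
    where
    scaled : (U p ≡ ratio p r * U r) × (V p ≡ ratio p r * V r)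
    scaled = same-direction⇒scaled p r p≢N r≢N same-direction

  W≡0⇒same-direction : ∀ p r → p ≢ nucleus → r ≢ nucleus → W p r ≡ 0# → direction p ≡ direction r
  W≡0⇒same-direction p r p≢N r≢N W≡0 with U p ≟ 0# | U r ≟ 0# | +≡0⇒≡ W≡0
  ... | yes _ | yes _ | _ = refl
  ... | yes up≡0 | no ur≢0 | cross≡ = ⊥-elim (p≢N (nucleus-unique p up≡0 (*-cancelˡ-0 ur≢0 (begin
    U r * V p   ≡⟨ *-comm (U r) (V p) ⟩
    V p * U r   ≡⟨ sym cross≡ ⟩
    U p * V r   ≡⟨ cong (_* V r) up≡0 ⟩
    0# * V r    ≡⟨ zeroˡ (V r) ⟩
    0# ∎))))
  ... | no up≢0 | yes ur≡0 | cross≡ = ⊥-elim (r≢N (nucleus-unique r ur≡0 (*-cancelˡ-0 up≢0 (begin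
    U p * V r   ≡⟨ cross≡ ⟩
    V p * U r   ≡⟨ cong (V p *_) ur≡0 ⟩
    V p * 0#    ≡⟨ zeroʳ (V p) ⟩
    0# ∎))))
  ... | no up≢0 | no ur≢0 | cross≡ = cong rank (cross-div up≢0 ur≢0 cross≡)

  S≡0⇒height≡0 : ∀ p → S p ≡ 0# → height p ≡ 0#
  S≡0⇒height≡0 p S≡0 = trans (cong (_* inv (scale p)) S≡0) (zeroˡ _)

  height≡0⇒S≡0 : ∀ p → p ≢ nucleus → height p ≡ 0# → S p ≡ 0#
  height≡0⇒S≡0 p p≢N h≡0 = *-cancelʳ-0 (inv-nonzero (scale p) (scale-nonzero p p≢N)) h≡0

  next : ℕ → ℕ
  next i with i ℕ.≟ q
  ... | yes _ = 0
  ... | no _ = suc i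

  next≤q : ∀ i → i ≤ q → next i ≤ q
  next≤q i i≤q with i ℕ.≟ q
  ... | yes _ = z≤n
  ... | no i≢q = ℕ.≤∧≢⇒< i≤q i≢q

  next-injective : ∀ i j → i ≤ q → j ≤ q → next i ≡ next j → i ≡ j
  next-injective i j _ _ next≡ with i ℕ.≟ q | j ℕ.≟ q
  ... | yes i≡q | yes j≡q = trans i≡q (sym j≡q)
  ... | yes _ | no _ = ⊥-elim (ℕ.0≢1+n next≡)
  ... | no _ | yes _ = ⊥-elim (ℕ.0≢1+n (sym next≡))
  ... | no _ | no _ = ℕ.suc-injective next≡

  -- next moves every direction, even when followed by one more step (here q ≥ 2 is used).
  next-moves : ∀ i → next i ≢ i
  next-moves i with i ℕ.≟ q
  ... | yes i≡q = λ 0≡i → ℕ.<⇒≢ (ℕ.<-≤-trans (s≤s z≤n) 2≤q) (trans 0≡i i≡q)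
  ... | no _ = ℕ.1+n≢n

  next-moves-twice : ∀ i → suc (next i) ≢ i
  next-moves-twice i with i ℕ.≟ q
  ... | yes i≡q = λ 1≡i → ℕ.<⇒≢ 2≤q (trans 1≡i i≡q)
  ... | no _ = λ 2+i≡i → ℕ.<-irrefl (sym 2+i≡i) (ℕ.<-trans (ℕ.n<1+n i) (ℕ.n<1+n (suc i)))

  -- Block b holds the non-absolute points of direction b, followed by the
  -- absolute point of the preceding direction; slot = rank of the height.
  block : Point → ℕ
  block p with S p ≟ 0#
  ... | yes _ = next (direction p)
  ... | no _ = direction p

  block-absolute : ∀ p → S p ≡ 0# → block p ≡ next (direction p)
  block-absolute p S≡0 with S p ≟ 0#
  ... | yes _ = refl
  ... | no S≢0 = ⊥-elim (S≢0 S≡0)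

  block-non-absolute : ∀ p → S p ≢ 0# → block p ≡ direction p
  block-non-absolute p S≢0 with S p ≟ 0#
  ... | yes S≡0 = ⊥-elim (S≢0 S≡0)
  ... | no _ = refl

  block≤q : ∀ p → block p ≤ q
  block≤q p with S p ≟ 0#
  ... | yes _ = next≤q (direction p) (direction≤q p)
  ... | no _ = direction≤q p

  slot : Point → ℕ
  slot p = rank (height p)

  S≡0⇒last-slot : ∀ p → S p ≡ 0# → slot p ≡ pred q
  S≡0⇒last-slot p S≡0 = trans (cong rank (S≡0⇒height≡0 p S≡0)) rank-zero

  last-slot⇒S≡0 : ∀ p → p ≢ nucleus → slot p ≡ pred q → S p ≡ 0#
  last-slot⇒S≡0 p p≢N last = height≡0⇒S≡0 p p≢N (rank-injective (trans last (sym rank-zero)))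

  -- The label of a point p ≠ N: slot p in block p, shifted past the labels 0 and 1.
  point-label : Point → ℕ
  point-label p = 2 ℕ.+ (slot p ℕ.+ block p ℕ.* q)

  point-label-injective : ∀ p r → p ≢ nucleus → r ≢ nucleus → point-label p ≡ point-label r → p ≡ r
  point-label-injective p r p≢N r≢N label≡ =
    direction-height-injective p r p≢N r≢N (same-direction (S p ≟ 0#)) same-height
    where
    slots-blocks : slot p ≡ slot r × block p ≡ block r
    slots-blocks = slot-block-unique (block p) (block r) (rank<q (height p)) (rank<q (height r))
                     (ℕ.+-cancelˡ-≡ 2 (slot p ℕ.+ block p ℕ.* q) (slot r ℕ.+ block r ℕ.* q) label≡)
    same-height : height p ≡ height r
    same-height = rank-injective (proj₁ slots-blocks)
    same-direction : Dec (S p ≡ 0#) → direction p ≡ direction r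
    same-direction (yes Sp≡0) = next-injective _ _ (direction≤q p) (direction≤q r) (begin
      next (direction p)  ≡⟨ sym (block-absolute p Sp≡0) ⟩
      block p             ≡⟨ proj₂ slots-blocks ⟩
      block r             ≡⟨ block-absolute r Sr≡0 ⟩
      next (direction r) ∎)
      where
      Sr≡0 : S r ≡ 0#
      Sr≡0 = height≡0⇒S≡0 r r≢N (trans (sym same-height) (S≡0⇒height≡0 p Sp≡0))
    same-direction (no Sp≢0) = begin
      direction p   ≡⟨ sym (block-non-absolute p Sp≢0) ⟩
      block p       ≡⟨ proj₂ slots-blocks ⟩
      block r       ≡⟨ block-non-absolute r Sr≢0 ⟩
      direction r ∎
      where
      Sr≢0 : S r ≢ 0#
      Sr≢0 Sr≡0 = Sp≢0 (height≡0⇒S≡0 p p≢N (trans same-height (S≡0⇒height≡0 r Sr≡0)))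

  dot-absoluteˡ : ∀ p r → S p ≡ 0# → dot p r ≡ W p r
  dot-absoluteˡ p r Sp≡0 = trans (dot-invariant p r)
    (trans (cong (λ t → t * S r + W p r) Sp≡0) (trans (cong (_+ W p r) (zeroˡ (S r))) (+-identityˡ (W p r))))

  dot-absoluteʳ : ∀ p r → S r ≡ 0# → dot p r ≡ W p r
  dot-absoluteʳ p r Sr≡0 = trans (dot-invariant p r)
    (trans (cong (λ t → S p * t + W p r) Sr≡0) (trans (cong (_+ W p r) (zeroʳ (S p))) (+-identityˡ (W p r))))

  -- Consecutive slots of one block: p is not absolute (its slot is not the last);
  -- if r is not absolute either, both lie on one line through N and dot p r =
  -- s(p) s(r) ≠ 0; if r is absolute, its direction differs from that of p.
  consecutive-within-block : ∀ p r → p ≢ nucleus → r ≢ nucleus →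
    suc (slot p) ≡ slot r → block p ≡ block r → dot p r ≢ 0#
  consecutive-within-block p r p≢N r≢N next-slot same-block = by-absoluteness (S r ≟ 0#)
    where
    Sp≢0 : S p ≢ 0#
    Sp≢0 Sp≡0 = ℕ.<-irrefl refl (subst (_< q) (sym q≡slot-r) (rank<q (height r)))
      where
      q≡slot-r : q ≡ slot r
      q≡slot-r = trans (sym (ℕ.suc-pred q)) (trans (cong suc (sym (S≡0⇒last-slot p Sp≡0))) next-slot)
    by-absoluteness : Dec (S r ≡ 0#) → dot p r ≢ 0#
    by-absoluteness (no Sr≢0) pr≡0 = *-nonzero Sp≢0 Sr≢0 (begin
      S p * S r           ≡⟨ sym (+-identityʳ (S p * S r)) ⟩
      S p * S r + 0#      ≡⟨ cong (S p * S r +_) (sym (same-direction⇒W≡0 p r p≢N r≢N same-direction)) ⟩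
      S p * S r + W p r   ≡⟨ sym (dot-invariant p r) ⟩
      dot p r             ≡⟨ pr≡0 ⟩
      0# ∎)
      where
      same-direction : direction p ≡ direction r
      same-direction = trans (sym (block-non-absolute p Sp≢0)) (trans same-block (block-non-absolute r Sr≢0))
    by-absoluteness (yes Sr≡0) pr≡0 = next-moves (direction r) (begin
      next (direction r)  ≡⟨ sym (block-absolute r Sr≡0) ⟩
      block r             ≡⟨ sym same-block ⟩
      block p             ≡⟨ block-non-absolute p Sp≢0 ⟩
      direction p         ≡⟨ W≡0⇒same-direction p r p≢N r≢N (trans (sym (dot-absoluteʳ p r Sr≡0)) pr≡0) ⟩
      direction r ∎)

  -- The last slot of block b and the first slot of block b + 1: p is absolute and
  -- r is not, and the direction of r is next (direction p) + 1 ≠ direction p.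
  consecutive-across-blocks : ∀ p r → p ≢ nucleus → r ≢ nucleus →
    suc (slot p) ≡ q → 0 ≡ slot r → suc (block p) ≡ block r → dot p r ≢ 0#
  consecutive-across-blocks p r p≢N r≢N last-slot 0≡slot-r next-block pr≡0 = next-moves-twice (direction p) (begin
    suc (next (direction p))  ≡⟨ cong suc (sym (block-absolute p Sp≡0)) ⟩
    suc (block p)             ≡⟨ next-block ⟩
    block r                   ≡⟨ block-non-absolute r Sr≢0 ⟩
    direction r               ≡⟨ sym (W≡0⇒same-direction p r p≢N r≢N (trans (sym (dot-absoluteˡ p r Sp≡0)) pr≡0)) ⟩
    direction p ∎)
    where
    Sp≡0 : S p ≡ 0#
    Sp≡0 = last-slot⇒S≡0 p p≢N (ℕ.suc-injective (trans last-slot (sym (ℕ.suc-pred q))))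
    Sr≢0 : S r ≢ 0#
    Sr≢0 Sr≡0 = pred-q≢0 (trans (sym (S≡0⇒last-slot r Sr≡0)) (sym 0≡slot-r))

  point-label-consecutive : ∀ p r → p ≢ nucleus → r ≢ nucleus → suc (point-label p) ≡ point-label r → dot p r ≢ 0#
  point-label-consecutive p r p≢N r≢N consecutive
    with slot-block-successor (block p) (block r) (rank<q (height p)) (rank<q (height r))
           (ℕ.+-cancelˡ-≡ 2 (suc (slot p ℕ.+ block p ℕ.* q)) (slot r ℕ.+ block r ℕ.* q) consecutive)
  ... | inj₁ (next-slot , same-block) = consecutive-within-block p r p≢N r≢N next-slot same-block
  ... | inj₂ (last-slot , 0≡slot-r , next-block) = consecutive-across-blocks p r p≢N r≢N last-slot 0≡slot-r next-block

  label : Maybe Point → ℕ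
  label nothing = 0
  label (just p) with p ≟P nucleus
  ... | yes _ = 1
  ... | no _ = point-label p

  label-nucleus : ∀ p → p ≡ nucleus → label (just p) ≡ 1
  label-nucleus p p≡N with p ≟P nucleus
  ... | yes _ = refl
  ... | no p≢N = ⊥-elim (p≢N p≡N)

  label-point : ∀ p → p ≢ nucleus → label (just p) ≡ point-label p
  label-point p p≢N with p ≟P nucleus
  ... | yes p≡N = ⊥-elim (p≢N p≡N)
  ... | no _ = refl

  label-just≢0 : ∀ p → label (just p) ≢ 0
  label-just≢0 p with p ≟P nucleus
  ... | yes _ = λ ()
  ... | no _ = λ ()

  label-injective : ∀ a b → label a ≡ label b → a ≡ b
  label-injective nothing nothing _ = refl
  label-injective nothing (just r) 0≡label = ⊥-elim (label-just≢0 r (sym 0≡label))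
  label-injective (just p) nothing label≡0 = ⊥-elim (label-just≢0 p label≡0)
  label-injective (just p) (just r) label≡ = cong just (by-nucleus (p ≟P nucleus) (r ≟P nucleus))
    where
    by-nucleus : Dec (p ≡ nucleus) → Dec (r ≡ nucleus) → p ≡ r
    by-nucleus (yes p≡N) (yes r≡N) = trans p≡N (sym r≡N)
    by-nucleus (yes p≡N) (no r≢N) =
      ⊥-elim (ℕ.0≢1+n (ℕ.suc-injective (trans (sym (label-nucleus p p≡N)) (trans label≡ (label-point r r≢N)))))
    by-nucleus (no p≢N) (yes r≡N) =
      ⊥-elim (ℕ.1+n≢0 (ℕ.suc-injective (trans (sym (label-point p p≢N)) (trans label≡ (label-nucleus r r≡N)))))
    by-nucleus (no p≢N) (no r≢N) =
      point-label-injective p r p≢N r≢N (trans (sym (label-point p p≢N)) (trans label≡ (label-point r r≢N)))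

  consecutive-non-adjacent : ∀ a b → suc (label a) ≡ label b → ¬ TAdj a b
  consecutive-non-adjacent nothing nothing _ ()
  consecutive-non-adjacent nothing (just r) 1≡label = by-nucleus (r ≟P nucleus)
    where
    by-nucleus : Dec (r ≡ nucleus) → ¬ TAdj nothing (just r)
    by-nucleus (yes refl) joined = 1≢0 (trans (sym S-nucleus) (joined-to-new⇒S≡0 nucleus joined))
    by-nucleus (no r≢N) _ = ℕ.0≢1+n (ℕ.suc-injective (trans 1≡label (label-point r r≢N)))
  consecutive-non-adjacent (just p) nothing 1+label≡0 _ = ℕ.1+n≢0 1+label≡0
  consecutive-non-adjacent (just p) (just r) consecutive = by-nucleus (p ≟P nucleus) (r ≟P nucleus)
    where
    by-nucleus : Dec (p ≡ nucleus) → Dec (r ≡ nucleus) → ¬ HAdj p r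
    by-nucleus (yes p≡N) (yes r≡N) (p≢r , _) = p≢r (trans p≡N (sym r≡N))
    by-nucleus (yes refl) (no r≢N) (_ , Nr≡0) = pred-q≢0 (begin
      pred q    ≡⟨ sym (S≡0⇒last-slot r (trans (sym (dot-nucleus r)) Nr≡0)) ⟩
      slot r    ≡⟨ ℕ.m+n≡0⇒m≡0 (slot r) (ℕ.suc-injective (ℕ.suc-injective (sym 2≡label))) ⟩
      0 ∎)
      where
      2≡label : 2 ≡ point-label r
      2≡label = trans (cong suc (sym (label-nucleus nucleus refl))) (trans consecutive (label-point r r≢N))
    by-nucleus (no p≢N) (yes r≡N) _ =
      ℕ.1+n≢0 (ℕ.suc-injective (trans (cong suc (sym (label-point p p≢N))) (trans consecutive (label-nucleus r r≡N))))
    by-nucleus (no p≢N) (no r≢N) (_ , pr≡0) = point-label-consecutive p r p≢N r≢N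
      (trans (cong suc (sym (label-point p p≢N))) (trans consecutive (label-point r r≢N))) pr≡0

  -- The largest label q² + q + 1, carried by the absolute point A.
  M : ℕ
  M = suc (q ℕ.+ q ℕ.* q)

  point-label≤M : ∀ p → point-label p ≤ M
  point-label≤M p = ℕ.≤-trans
    (ℕ.+-monoʳ-≤ 2 (ℕ.+-mono-≤ (ℕ.<⇒≤pred (rank<q (height p))) (ℕ.*-monoˡ-≤ q (block≤q p))))
    (ℕ.≤-reflexive (cong (λ t → suc (t ℕ.+ q ℕ.* q)) (ℕ.suc-pred q)))

  label≤M : ∀ a → label a ≤ M
  label≤M nothing = z≤n
  label≤M (just p) = by-nucleus (p ≟P nucleus)
    where
    by-nucleus : Dec (p ≡ nucleus) → label (just p) ≤ M
    by-nucleus (yes p≡N) = subst (_≤ M) (sym (label-nucleus p p≡N)) (s≤s z≤n)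
    by-nucleus (no p≢N) = subst (_≤ M) (sym (label-point p p≢N)) (point-label≤M p)

  direction-U≢0 : ∀ p → U p ≢ 0# → direction p ≡ rank (V p * inv (U p))
  direction-U≢0 p U≢0 = by-U (U p ≟ 0#)
    where
    by-U : (d : Dec (U p ≡ 0#)) → direction-of p d ≡ rank (V p * inv (U p))
    by-U (yes U≡0) = ⊥-elim (U≢0 U≡0)
    by-U (no _) = refl

  next-below : ∀ i → i < q → next i ≡ suc i
  next-below i i<q with i ℕ.≟ q
  ... | yes i≡q = ⊥-elim (ℕ.<⇒≢ i<q i≡q)
  ... | no _ = refl

  -- A has v(A) = 0, so direction pred q and block q, and it sits in the last
  -- slot: its label is the maximum M.
  absolute-point≢nucleus : absolute-point ≢ nucleus
  absolute-point≢nucleus A≡N = 1≢0 (trans (sym S-nucleus) (trans (cong S (sym A≡N)) S-absolute-point))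

  label-absolute-point : label (just absolute-point) ≡ M
  label-absolute-point = begin
    label (just absolute-point)   ≡⟨ label-point absolute-point absolute-point≢nucleus ⟩
    2 ℕ.+ (slot absolute-point ℕ.+ block absolute-point ℕ.* q)
      ≡⟨ cong₂ (λ s b → 2 ℕ.+ (s ℕ.+ b ℕ.* q)) (S≡0⇒last-slot absolute-point S-absolute-point) block-A ⟩
    2 ℕ.+ (pred q ℕ.+ q ℕ.* q)    ≡⟨ cong (λ t → suc (t ℕ.+ q ℕ.* q)) (ℕ.suc-pred q) ⟩
    M ∎
    where
    U-A≢0 : U absolute-point ≢ 0#
    U-A≢0 U≡0 = 1≢0 (trans (sym (+-identityˡ 1#)) U≡0)
    direction-A : direction absolute-point ≡ pred q
    direction-A = begin
      direction absolute-point                           ≡⟨ direction-U≢0 absolute-point U-A≢0 ⟩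
      rank (V absolute-point * inv (U absolute-point))   ≡⟨ cong (λ t → rank (t * inv (U absolute-point))) char2 ⟩
      rank (0# * inv (U absolute-point))                 ≡⟨ cong rank (zeroˡ _) ⟩
      rank 0#                                            ≡⟨ rank-zero ⟩
      pred q ∎
    block-A : block absolute-point ≡ q
    block-A = begin
      block absolute-point               ≡⟨ block-absolute absolute-point S-absolute-point ⟩
      next (direction absolute-point)    ≡⟨ cong next direction-A ⟩
      next (pred q)                      ≡⟨ next-below (pred q) pred-q<q ⟩
      suc (pred q)                       ≡⟨ ℕ.suc-pred q ⟩
      q ∎

  adjacent⇒distinct : ∀ a b → TAdj a b → a ≢ b
  adjacent⇒distinct (just p) (just r) (p≢r , _) refl = p≢r refl
  adjacent⇒distinct (just p) nothing _ ()
  adjacent⇒distinct nothing (just r) _ ()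


module L21Labelling (F : Field) (q : ℕ) (e : Fin q ↔ Field.Carrier F)
                    (char2 : Field._+_ F (Field.1# F) (Field.1# F) ≡ Field.0# F) (2≤q : 2 ℕ.≤ q) where
  open import Data.Maybe using (Maybe; just; nothing)
  open import Data.Product using (_,_)
  open import Data.Integer using (ℤ; +_; ∣_∣; _-_)
  import Data.Integer.Properties as ℤ
  open import Relation.Binary.PropositionalEquality
  open Labelling F q e char2 2≤q public
  open LabelDifferences

  labelling : Maybe Point → ℤ
  labelling a = + label a

  labelling-is-L21 : IsL21 Htilde labelling
  labelling-is-L21 = separated-by-two , (λ a b (a≢b , _) fa≡fb → a≢b (label-injective a b (ℤ.+-injective fa≡fb)))
    where
    separated-by-two : ∀ a b → TAdj a b → 2 ℕ.≤ ∣ labelling a - labelling b ∣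
    separated-by-two a b adj = distance-two (label a) (label b)
      (λ label≡ → adjacent⇒distinct a b adj (label-injective a b label≡))
      (λ consecutive → consecutive-non-adjacent a b consecutive adj)
      (λ consecutive → consecutive-non-adjacent b a consecutive (TAdj-sym a b adj))

  labelling-span : HasSpan Htilde labelling (+ M)
  labelling-span = (λ a b → difference≤ (label b) (label≤M a)) ,
                   just absolute-point , nothing , trans (cong (λ t → + t - + 0) label-absolute-point) (ℤ.+-identityʳ (+ M))

-- In a graph of diameter at most two, L(2,1)-labels are pairwise distinct,
-- so a labelling of N vertices has span at least N - 1.
module DiameterTwoLowerBound (G : FinGraph) where
  import Data.Nat as ℕ
  import Data.Nat.Properties as ℕ
  open import Data.Integer using (ℤ; +_; ∣_∣; _-_; _≤_; +≤+)
  import Data.Integer.Properties as ℤ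
  open import Data.Fin using (toℕ; fromℕ<)
  import Data.Fin.Properties as Fin
  open import Data.Product using (_×_; _,_; ∃)
  open import Data.Sum using (_⊎_; [_,_]′)
  open import Data.Empty using (⊥-elim)
  open import Relation.Nullary using (¬_; yes; no)
  open import Relation.Binary.PropositionalEquality
  open FinGraph G
  open LabelDifferences

  WithinTwo : Set
  WithinTwo = ∀ u v → u ≢ v → (u ~ v) ⊎ (∃ λ w → u ~ w × w ~ v)

  L21-injective : WithinTwo → ∀ f → IsL21 G f → ∀ u v → u ≢ v → f u ≢ f v
  L21-injective within f (gap , separated) u v u≢v fu≡fv =
    [ not-adjacent , (λ { (w , u~w , w~v) → separated u v (u≢v , not-adjacent , w , u~w , w~v) fu≡fv }) ]′ (within u v u≢v)
    where
    2≰0 : ¬ (2 ℕ.≤ 0)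
    2≰0 ()
    not-adjacent : ¬ (u ~ v)
    not-adjacent u~v = 2≰0 (subst (2 ℕ.≤_) difference-zero (gap u v u~v))
      where
      difference-zero : ∣ f u - f v ∣ ≡ 0
      difference-zero = trans (cong (λ t → ∣ t - f v ∣) fu≡fv) (cong ∣_∣ (ℤ.+-inverseʳ (f v)))

  span-lower-bound : WithinTwo → ∀ m (ι : Fin (suc m) → V) → (∀ {i j} → ι i ≡ ι j → i ≡ j) →
    ∀ f s → IsL21 G f → HasSpan G f s → + m ≤ s
  -- The offsets f x - f v₀ from the minimum lie in 0 .. s and are injective on
  -- the m + 1 enumerated vertices, so m + 1 ≤ s + 1 by the pigeonhole principle.
  span-lower-bound within m ι ι-injective f s L21 (bounded , u₀ , v₀ , span≡) =
    subst (+ m ≤_) +∣s∣≡s (+≤+ (ℕ.≤-pred (Fin.injective⇒≤ φ-injective)))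
    where
    offset : V → ℤ
    offset x = f x - f v₀
    offset-nonneg : ∀ x → + 0 ≤ offset x
    offset-nonneg x = ℤ.i≤j⇒0≤j-i (sub-antitone (f u₀) (f v₀) (f x) (subst (f u₀ - f x ≤_) (sym span≡) (bounded u₀ x)))
    +∣s∣≡s : + ∣ s ∣ ≡ s
    +∣s∣≡s = ℤ.0≤i⇒+∣i∣≡i (subst (+ 0 ≤_) span≡ (offset-nonneg u₀))
    +∣offset∣ : ∀ x → + ∣ offset x ∣ ≡ offset x
    +∣offset∣ x = ℤ.0≤i⇒+∣i∣≡i (offset-nonneg x)
    ∣offset∣≤∣s∣ : ∀ x → ∣ offset x ∣ ℕ.≤ ∣ s ∣
    ∣offset∣≤∣s∣ x = ℤ.drop‿+≤+ (subst₂ _≤_ (sym (+∣offset∣ x)) (sym +∣s∣≡s) (bounded x v₀))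
    φ : Fin (suc m) → Fin (suc ∣ s ∣)
    φ i = fromℕ< (ℕ.s≤s (∣offset∣≤∣s∣ (ι i)))
    φ-injective : ∀ {i j} → φ i ≡ φ j → i ≡ j
    φ-injective {i} {j} φi≡φj with i Data.Fin.≟ j
    ... | yes i≡j = i≡j
    ... | no i≢j = ⊥-elim (L21-injective within f L21 (ι i) (ι j) (λ ιi≡ιj → i≢j (ι-injective ιi≡ιj))
                                         (sub-cancelʳ (f (ι i)) (f (ι j)) (f v₀) (begin
      offset (ι i)               ≡⟨ sym (+∣offset∣ (ι i)) ⟩
      + ∣ offset (ι i) ∣         ≡⟨ cong +_ (trans (sym (Fin.toℕ-fromℕ< _)) (trans (cong toℕ φi≡φj) (Fin.toℕ-fromℕ< _))) ⟩
      + ∣ offset (ι j) ∣         ≡⟨ +∣offset∣ (ι j) ⟩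
      offset (ι j) ∎)))
      where open ≡-Reasoning

open import Data.Nat using (ℕ; _≤_; _^_; _+_; _*_; _∸_)
open import Data.Integer using (+_)
open import Data.Fin using (Fin)
open import Data.Product using (_×_)
open import Function.Bundles using (_↔_)

import Data.Nat.Properties as ℕ
open import Data.Product using (_,_; proj₁)
open import Relation.Binary.PropositionalEquality using (cong; subst; sym; module ≡-Reasoning)

Δ-formula : ∀ q → (q + 1) * (q + 1) ∸ (q + 1) + 1 ≡ suc (q + q * q)
Δ-formula q = begin
  (q + 1) * (q + 1) ∸ (q + 1) + 1             ≡⟨ cong (λ t → t ∸ (q + 1) + 1) (square q) ⟩
  (q + q * q) + (q + 1) ∸ (q + 1) + 1         ≡⟨ cong (_+ 1) (ℕ.m+n∸n≡m (q + q * q) (q + 1)) ⟩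
  (q + q * q) + 1                             ≡⟨ ℕ.+-comm (q + q * q) 1 ⟩
  suc (q + q * q) ∎
  where
  open ≡-Reasoning
  square : ∀ q → (q + 1) * (q + 1) ≡ (q + q * q) + (q + 1)
  square = solve-∀
    where open import Data.Nat.Tactic.RingSolver

2≤2^k : ∀ k → 1 ≤ k → 2 ≤ 2 ^ k
2≤2^k (suc j) _ = ℕ.*-monoʳ-≤ 2 (ℕ.m^n>0 2 j)

mainTheorem9 : (k : ℕ) → 1 ≤ k → (F : Field) → (e : Fin (2 ^ k) ↔ Field.Carrier F) →
    let n = 2 ^ k
        G = Polarity.Htilde F n e
        Δ = n + 1
    in Regular G Δ × Diameter2 G × Lambda21≡ G (+ (Δ * Δ ∸ Δ + 1))
mainTheorem9 k 1≤k F e =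
  regular , diameter-two ,
  subst (λ m → Lambda21≡ Htilde (+ m)) (sym (Δ-formula (2 ^ k)))
    ( (labelling , labelling-is-L21 , labelling-span)
    , DiameterTwoLowerBound.span-lower-bound Htilde (proj₁ diameter-two) M
        vertex-enumeration vertex-enumeration-injective )
  where
  open L21Labelling F (2 ^ k) e (CharacteristicTwo.characteristic-two F k e) (2≤2^k k 1≤k)
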